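{- There is a decidable stably infinite theory $\mathcal{T}'$ such that, for every decidable theory $\mathcal{T}$, if $\mathcal{T}\sqcup\mathcal{T}'$ is decidable then $\mathcal{T}$ is stably infinite.
   Context: All logic is one-sorted first-order logic with equality, and all signatures are countable. A $\Sigma$-theory is a set of $\Sigma$-sentences; a $\mathcal{T}$-interpretation is a $\Sigma$-structure (nonempty domain) with a variable assignment satisfying all axioms of $\mathcal{T}$. $\mathcal{T}$ is decidable if there is an algorithm deciding, for a quantifier-free $\Sigma$-formula, whether some $\mathcal{T}$-interpretation satisfies it. For theories $\mathcal{T}_1,\mathcal{T}_2$, the disjoint combination $\mathcal{T}_1\sqcup\mathcal{T}_2$ is the theory over the disjoint union of their signatures (renamed to share only equality) axiomatized by the union of their axioms. A theory $\mathcal{T}$ is stably infinite if every $\mathcal{T}$-satisfiable quantifier-free formula is satisfied by some $\mathcal{T}$-interpretation with infinite domain. -}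

module Defs where

open import Data.Nat using (ℕ; zero; suc; _+_; _*_; _^_; _<_; _≟_)
open import Data.Fin using (Fin)
open import Data.Vec using (Vec; []; _∷_; lookup)
open import Data.Sum using (_⊎_; inj₁; inj₂)
open import Data.Product using (Σ; _×_; _,_)
open import Data.Empty using (⊥)
open import Data.Bool using (true; false)
open import Relation.Nullary using (¬_; does)
open import Relation.Binary.PropositionalEquality using (_≡_; _≢_; subst)
open import Function.Definitions using (Injective)

-- Model of computation: μ-recursive functions with big-step semantics.
-- "There is an algorithm" = "there is a μ-recursive function".

data μR : ℕ → Set where
  zer  : ∀ {n} → μR n
  succ : μR 1
  prj  : ∀ {n} → Fin n → μR n
  comp : ∀ {n m} → μR m → Vec (μR n) m → μR n
  prec : ∀ {n} → μR n → μR (suc (suc n)) → μR (suc n)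
  mini : ∀ {n} → μR (suc n) → μR n

mutual
  data Eval : ∀ {n} → μR n → Vec ℕ n → ℕ → Set where
    e-zer  : ∀ {n} {xs : Vec ℕ n} → Eval zer xs 0
    e-succ : ∀ {x} → Eval succ (x ∷ []) (suc x)
    e-prj  : ∀ {n} {i : Fin n} {xs} → Eval (prj i) xs (lookup xs i)
    e-comp : ∀ {n m} {f : μR m} {gs : Vec (μR n) m} {xs ys y} →
             EvalVec gs xs ys → Eval f ys y → Eval (comp f gs) xs y
    e-rec0 : ∀ {n} {g : μR n} {h} {xs y} →
             Eval g xs y → Eval (prec g h) (0 ∷ xs) y
    e-recS : ∀ {n} {g : μR n} {h} {k xs y z} →
             Eval (prec g h) (k ∷ xs) y → Eval h (k ∷ y ∷ xs) z →
             Eval (prec g h) (suc k ∷ xs) z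
    e-mini : ∀ {n} {f : μR (suc n)} {xs k} →
             Eval f (k ∷ xs) 0 →
             (∀ m → m < k → Σ ℕ λ v → Eval f (m ∷ xs) (suc v)) →
             Eval (mini f) xs k

  data EvalVec : ∀ {n m} → Vec (μR n) m → Vec ℕ n → Vec ℕ m → Set where
    ev-[] : ∀ {n} {xs : Vec ℕ n} → EvalVec [] xs []
    ev-∷  : ∀ {n m} {g : μR n} {gs : Vec (μR n) m} {xs y ys} →
            Eval g xs y → EvalVec gs xs ys → EvalVec (g ∷ gs) xs (y ∷ ys)

-- Countable signatures (symbols come with an injective coding into ℕ)

record Signature : Set₁ where
  field
    Fun    : Set
    Rel    : Set
    farity : Fun → ℕ
    rarity : Rel → ℕ
    fcode  : Fun → ℕ
    rcode  : Rel → ℕ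
    fcode-inj : Injective _≡_ _≡_ fcode
    rcode-inj : Injective _≡_ _≡_ rcode
open Signature public

Var : Set
Var = ℕ

data Term (S : Signature) : Set where
  var : Var → Term S
  app : (f : Fun S) → Vec (Term S) (farity S f) → Term S

data Formula (S : Signature) : Set where
  ⊥'   : Formula S
  _≐_  : Term S → Term S → Formula S
  rel  : (r : Rel S) → Vec (Term S) (rarity S r) → Formula S
  ¬'_  : Formula S → Formula S
  _∧'_ : Formula S → Formula S → Formula S
  _∨'_ : Formula S → Formula S → Formula S
  _⇒'_ : Formula S → Formula S → Formula S
  ∀'   : Var → Formula S → Formula S
  ∃'   : Var → Formula S → Formula S

data QF {S : Signature} : Formula S → Set where
  qf-⊥ : QF ⊥'
  qf-≐ : ∀ {t u} → QF (t ≐ u)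
  qf-r : ∀ {r ts} → QF (rel r ts)
  qf-¬ : ∀ {φ} → QF φ → QF (¬' φ)
  qf-∧ : ∀ {φ ψ} → QF φ → QF ψ → QF (φ ∧' ψ)
  qf-∨ : ∀ {φ ψ} → QF φ → QF ψ → QF (φ ∨' ψ)
  qf-⇒ : ∀ {φ ψ} → QF φ → QF ψ → QF (φ ⇒' ψ)

mutual
  data OccT {S : Signature} (x : Var) : Term S → Set where
    o-var : OccT x (var x)
    o-app : ∀ {f ts} → OccV x ts → OccT x (app f ts)

  data OccV {S : Signature} (x : Var) : ∀ {n} → Vec (Term S) n → Set where
    o-here  : ∀ {n t} {ts : Vec (Term S) n} → OccT x t → OccV x (t ∷ ts)
    o-there : ∀ {n t} {ts : Vec (Term S) n} → OccV x ts → OccV x (t ∷ ts)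

data FreeIn {S : Signature} (x : Var) : Formula S → Set where
  f-≐ˡ : ∀ {t u} → OccT x t → FreeIn x (t ≐ u)
  f-≐ʳ : ∀ {t u} → OccT x u → FreeIn x (t ≐ u)
  f-r  : ∀ {r ts} → OccV x ts → FreeIn x (rel r ts)
  f-¬  : ∀ {φ} → FreeIn x φ → FreeIn x (¬' φ)
  f-∧ˡ : ∀ {φ ψ} → FreeIn x φ → FreeIn x (φ ∧' ψ)
  f-∧ʳ : ∀ {φ ψ} → FreeIn x ψ → FreeIn x (φ ∧' ψ)
  f-∨ˡ : ∀ {φ ψ} → FreeIn x φ → FreeIn x (φ ∨' ψ)
  f-∨ʳ : ∀ {φ ψ} → FreeIn x ψ → FreeIn x (φ ∨' ψ)
  f-⇒ˡ : ∀ {φ ψ} → FreeIn x φ → FreeIn x (φ ⇒' ψ)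
  f-⇒ʳ : ∀ {φ ψ} → FreeIn x ψ → FreeIn x (φ ⇒' ψ)
  f-∀  : ∀ {y φ} → x ≢ y → FreeIn x φ → FreeIn x (∀' y φ)
  f-∃  : ∀ {y φ} → x ≢ y → FreeIn x φ → FreeIn x (∃' y φ)

Sentence : {S : Signature} → Formula S → Set
Sentence φ = ∀ x → ¬ FreeIn x φ

record Structure (S : Signature) : Set₁ where
  field
    D    : Set
    fun  : (f : Fun S) → Vec D (farity S f) → D
    rel' : (r : Rel S) → Vec D (rarity S r) → Set
open Structure public

Assignment : {S : Signature} → Structure S → Set
Assignment M = Var → D M

update : {A : Set} → (Var → A) → Var → A → (Var → A)
update a x d y with does (y ≟ x)
... | true  = d
... | false = a y

mutual
  evalT : {S : Signature} (M : Structure S) → Assignment M → Term S → D M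
  evalT M a (var x) = a x
  evalT M a (app f ts) = fun M f (evalV M a ts)

  evalV : {S : Signature} (M : Structure S) → Assignment M → {n : ℕ} → Vec (Term S) n → Vec (D M) n
  evalV M a [] = []
  evalV M a (t ∷ ts) = evalT M a t ∷ evalV M a ts

_,_⊨_ : {S : Signature} (M : Structure S) → Assignment M → Formula S → Set
M , a ⊨ ⊥' = ⊥
M , a ⊨ (t ≐ u) = evalT M a t ≡ evalT M a u
M , a ⊨ rel r ts = rel' M r (evalV M a ts)
M , a ⊨ (¬' φ) = ¬ (_,_⊨_ M a φ)
M , a ⊨ (φ ∧' ψ) = (_,_⊨_ M a φ) × (_,_⊨_ M a ψ)
M , a ⊨ (φ ∨' ψ) = (_,_⊨_ M a φ) ⊎ (_,_⊨_ M a ψ)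
M , a ⊨ (φ ⇒' ψ) = (_,_⊨_ M a φ) → (_,_⊨_ M a ψ)
M , a ⊨ ∀' x φ = (d : D M) → _,_⊨_ M (update a x d) φ
M , a ⊨ ∃' x φ = Σ (D M) λ d → _,_⊨_ M (update a x d) φ

record Theory (S : Signature) : Set₁ where
  field
    Ax       : Formula S → Set
    Ax-sentence : ∀ φ → Ax φ → Sentence φ
open Theory public

-- A T-interpretation: a structure with an assignment satisfying all axioms.
-- (The domain is nonempty since an assignment Var → D exists.)
IsModel : {S : Signature} → Theory S → (M : Structure S) → Assignment M → Set
IsModel T M a = ∀ φ → Ax T φ → M , a ⊨ φ

Sat : {S : Signature} → Theory S → Formula S → Set₁
Sat {S} T φ = Σ (Structure S) λ M → Σ (Assignment M) λ a → IsModel T M a × (M , a ⊨ φ)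

Infinite : Set → Set
Infinite A = Σ (ℕ → A) λ f → Injective _≡_ _≡_ f

SatInf : {S : Signature} → Theory S → Formula S → Set₁
SatInf {S} T φ = Σ (Structure S) λ M → Infinite (D M) ×
  (Σ (Assignment M) λ a → IsModel T M a × (M , a ⊨ φ))

StablyInfinite : {S : Signature} → Theory S → Set₁
StablyInfinite {S} T = ∀ (φ : Formula S) → QF φ → Sat T φ → SatInf T φ

pair : ℕ → ℕ → ℕ
pair a b = 2 ^ a * suc (2 * b)

mutual
  codeT : {S : Signature} → Term S → ℕ
  codeT (var x) = pair 0 x
  codeT {S} (app f ts) = pair 1 (pair (fcode S f) (codeV ts))

  codeV : {S : Signature} {n : ℕ} → Vec (Term S) n → ℕ
  codeV [] = 0
  codeV (t ∷ ts) = suc (pair (codeT t) (codeV ts))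

code : {S : Signature} → Formula S → ℕ
code ⊥' = pair 0 0
code (t ≐ u) = pair 1 (pair (codeT t) (codeT u))
code {S} (rel r ts) = pair 2 (pair (rcode S r) (codeV ts))
code (¬' φ) = pair 3 (code φ)
code (φ ∧' ψ) = pair 4 (pair (code φ) (code ψ))
code (φ ∨' ψ) = pair 5 (pair (code φ) (code ψ))
code (φ ⇒' ψ) = pair 6 (pair (code φ) (code ψ))
code (∀' x φ) = pair 7 (pair x (code φ))
code (∃' x φ) = pair 8 (pair x (code φ))

Decidable : {S : Signature} → Theory S → Set₁
Decidable {S} T = Σ (μR 1) λ e → ∀ (φ : Formula S) → QF φ →
  Σ ℕ λ b → Eval e (code φ ∷ []) b × ((b ≡ 0 → Sat T φ) × (b ≢ 0 → ¬ Sat T φ))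

private
  dbl-code : {A B : Set} → (A → ℕ) → (B → ℕ) → A ⊎ B → ℕ
  dbl-code c d (inj₁ x) = 2 * c x
  dbl-code c d (inj₂ y) = suc (2 * d y)

  [_,_]ᵃ : {A B : Set} → (A → ℕ) → (B → ℕ) → A ⊎ B → ℕ
  [ c , d ]ᵃ (inj₁ x) = c x
  [ c , d ]ᵃ (inj₂ y) = d y

open import Data.Nat.Properties using (*-cancelˡ-≡; suc-injective)
open import Data.Nat.Properties using (m≢1+n+m)
import Data.Nat.Properties as NP
open import Relation.Binary.PropositionalEquality using (refl; cong)

private
  dbl-inj : {A B : Set} (c : A → ℕ) (d : B → ℕ) →
    Injective _≡_ _≡_ c → Injective _≡_ _≡_ d →
    Injective _≡_ _≡_ (dbl-code c d)
  dbl-inj c d ci di {inj₁ x} {inj₁ y} e = cong inj₁ (ci (*-cancelˡ-≡ (c x) (c y) 2 e))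
  dbl-inj c d ci di {inj₂ x} {inj₂ y} e =
    cong inj₂ (di (*-cancelˡ-≡ (d x) (d y) 2 (suc-injective e)))
  dbl-inj c d ci di {inj₁ x} {inj₂ y} e with NP.even≢odd (c x) (d y) e
  ... | ()
  dbl-inj c d ci di {inj₂ x} {inj₁ y} e with NP.even≢odd (c y) (d x) (Relation.Binary.PropositionalEquality.sym e)
  ... | ()

_⊕_ : Signature → Signature → Signature
S₁ ⊕ S₂ = record
  { Fun = Fun S₁ ⊎ Fun S₂
  ; Rel = Rel S₁ ⊎ Rel S₂
  ; farity = [ farity S₁ , farity S₂ ]ᵃ
  ; rarity = [ rarity S₁ , rarity S₂ ]ᵃ
  ; fcode = dbl-code (fcode S₁) (fcode S₂)
  ; rcode = dbl-code (rcode S₁) (rcode S₂)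
  ; fcode-inj = dbl-inj _ _ (fcode-inj S₁) (fcode-inj S₂)
  ; rcode-inj = dbl-inj _ _ (rcode-inj S₁) (rcode-inj S₂)
  }

mutual
  liftT₁ : {S₁ S₂ : Signature} → Term S₁ → Term (S₁ ⊕ S₂)
  liftT₁ (var x) = var x
  liftT₁ (app f ts) = app (inj₁ f) (liftV₁ ts)

  liftV₁ : {S₁ S₂ : Signature} {n : ℕ} → Vec (Term S₁) n → Vec (Term (S₁ ⊕ S₂)) n
  liftV₁ [] = []
  liftV₁ (t ∷ ts) = liftT₁ t ∷ liftV₁ ts

mutual
  liftT₂ : {S₁ S₂ : Signature} → Term S₂ → Term (S₁ ⊕ S₂)
  liftT₂ (var x) = var x
  liftT₂ (app f ts) = app (inj₂ f) (liftV₂ ts)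

  liftV₂ : {S₁ S₂ : Signature} {n : ℕ} → Vec (Term S₂) n → Vec (Term (S₁ ⊕ S₂)) n
  liftV₂ [] = []
  liftV₂ (t ∷ ts) = liftT₂ t ∷ liftV₂ ts

lift₁ : {S₁ S₂ : Signature} → Formula S₁ → Formula (S₁ ⊕ S₂)
lift₁ ⊥' = ⊥'
lift₁ (t ≐ u) = liftT₁ t ≐ liftT₁ u
lift₁ (rel r ts) = rel (inj₁ r) (liftV₁ ts)
lift₁ (¬' φ) = ¬' lift₁ φ
lift₁ (φ ∧' ψ) = lift₁ φ ∧' lift₁ ψ
lift₁ (φ ∨' ψ) = lift₁ φ ∨' lift₁ ψ
lift₁ (φ ⇒' ψ) = lift₁ φ ⇒' lift₁ ψ
lift₁ (∀' x φ) = ∀' x (lift₁ φ)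
lift₁ (∃' x φ) = ∃' x (lift₁ φ)

lift₂ : {S₁ S₂ : Signature} → Formula S₂ → Formula (S₁ ⊕ S₂)
lift₂ ⊥' = ⊥'
lift₂ (t ≐ u) = liftT₂ t ≐ liftT₂ u
lift₂ (rel r ts) = rel (inj₂ r) (liftV₂ ts)
lift₂ (¬' φ) = ¬' lift₂ φ
lift₂ (φ ∧' ψ) = lift₂ φ ∧' lift₂ ψ
lift₂ (φ ∨' ψ) = lift₂ φ ∨' lift₂ ψ
lift₂ (φ ⇒' ψ) = lift₂ φ ⇒' lift₂ ψ
lift₂ (∀' x φ) = ∀' x (lift₂ φ)
lift₂ (∃' x φ) = ∃' x (lift₂ φ)

mutual
  occT₁ : {S₁ S₂ : Signature} {x : Var} (t : Term S₁) → OccT x (liftT₁ {S₁} {S₂} t) → OccT x t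
  occT₁ (var x) o-var = o-var
  occT₁ (app f ts) (o-app o) = o-app (occV₁ ts o)

  occV₁ : {S₁ S₂ : Signature} {x : Var} {n : ℕ} (ts : Vec (Term S₁) n) → OccV x (liftV₁ {S₁} {S₂} ts) → OccV x ts
  occV₁ (t ∷ ts) (o-here o) = o-here (occT₁ t o)
  occV₁ (t ∷ ts) (o-there o) = o-there (occV₁ ts o)

mutual
  occT₂ : {S₁ S₂ : Signature} {x : Var} (t : Term S₂) → OccT x (liftT₂ {S₁} {S₂} t) → OccT x t
  occT₂ (var x) o-var = o-var
  occT₂ (app f ts) (o-app o) = o-app (occV₂ ts o)

  occV₂ : {S₁ S₂ : Signature} {x : Var} {n : ℕ} (ts : Vec (Term S₂) n) → OccV x (liftV₂ {S₁} {S₂} ts) → OccV x ts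
  occV₂ (t ∷ ts) (o-here o) = o-here (occT₂ t o)
  occV₂ (t ∷ ts) (o-there o) = o-there (occV₂ ts o)

free₁ : {S₁ S₂ : Signature} {x : Var} (φ : Formula S₁) → FreeIn x (lift₁ {S₁} {S₂} φ) → FreeIn x φ
free₁ (t ≐ u) (f-≐ˡ o) = f-≐ˡ (occT₁ t o)
free₁ (t ≐ u) (f-≐ʳ o) = f-≐ʳ (occT₁ u o)
free₁ (rel r ts) (f-r o) = f-r (occV₁ ts o)
free₁ (¬' φ) (f-¬ p) = f-¬ (free₁ φ p)
free₁ (φ ∧' ψ) (f-∧ˡ p) = f-∧ˡ (free₁ φ p)
free₁ (φ ∧' ψ) (f-∧ʳ p) = f-∧ʳ (free₁ ψ p)
free₁ (φ ∨' ψ) (f-∨ˡ p) = f-∨ˡ (free₁ φ p)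
free₁ (φ ∨' ψ) (f-∨ʳ p) = f-∨ʳ (free₁ ψ p)
free₁ (φ ⇒' ψ) (f-⇒ˡ p) = f-⇒ˡ (free₁ φ p)
free₁ (φ ⇒' ψ) (f-⇒ʳ p) = f-⇒ʳ (free₁ ψ p)
free₁ (∀' y φ) (f-∀ n p) = f-∀ n (free₁ φ p)
free₁ (∃' y φ) (f-∃ n p) = f-∃ n (free₁ φ p)

free₂ : {S₁ S₂ : Signature} {x : Var} (φ : Formula S₂) → FreeIn x (lift₂ {S₁} {S₂} φ) → FreeIn x φ
free₂ (t ≐ u) (f-≐ˡ o) = f-≐ˡ (occT₂ t o)
free₂ (t ≐ u) (f-≐ʳ o) = f-≐ʳ (occT₂ u o)
free₂ (rel r ts) (f-r o) = f-r (occV₂ ts o)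
free₂ (¬' φ) (f-¬ p) = f-¬ (free₂ φ p)
free₂ (φ ∧' ψ) (f-∧ˡ p) = f-∧ˡ (free₂ φ p)
free₂ (φ ∧' ψ) (f-∧ʳ p) = f-∧ʳ (free₂ ψ p)
free₂ (φ ∨' ψ) (f-∨ˡ p) = f-∨ˡ (free₂ φ p)
free₂ (φ ∨' ψ) (f-∨ʳ p) = f-∨ʳ (free₂ ψ p)
free₂ (φ ⇒' ψ) (f-⇒ˡ p) = f-⇒ˡ (free₂ φ p)
free₂ (φ ⇒' ψ) (f-⇒ʳ p) = f-⇒ʳ (free₂ ψ p)
free₂ (∀' y φ) (f-∀ n p) = f-∀ n (free₂ φ p)
free₂ (∃' y φ) (f-∃ n p) = f-∃ n (free₂ φ p)

data CombAx {S₁ S₂ : Signature} (T₁ : Theory S₁) (T₂ : Theory S₂) : Formula (S₁ ⊕ S₂) → Set where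
  ax₁ : ∀ {φ} → Ax T₁ φ → CombAx T₁ T₂ (lift₁ φ)
  ax₂ : ∀ {φ} → Ax T₂ φ → CombAx T₁ T₂ (lift₂ φ)

_⊔_ : {S₁ S₂ : Signature} → Theory S₁ → Theory S₂ → Theory (S₁ ⊕ S₂)
T₁ ⊔ T₂ = record
  { Ax = CombAx T₁ T₂
  ; Ax-sentence = λ { _ (ax₁ {φ} a) x p → Ax-sentence T₁ φ a x (free₁ φ p)
                    ; _ (ax₂ {φ} a) x p → Ax-sentence T₂ φ a x (free₂ φ p) }
  }

{-# OPTIONS --safe #-}
-- T′ has nullary predicates P₀, P₁, … and, for every m in the diagonal set
-- Diagonal = {⌜ p ⌝ : the program p never outputs a positive number on input ⌜ p ⌝},
-- the axioms P_m → "beyond any k elements there is another one". Every structure with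
-- that freshness property is a T′-model, so T′ is stably infinite, and a quantifier-free
-- formula is T′-satisfiable iff it is satisfiable at all, which a bounded search over
-- assignments with values below the formula's code decides.
--
-- Let e decide T ⊔ T′ and let M be a T-model of φ. Let G be the program
-- n ↦ e ⌜ φ ∧ P_n ⌝ and n₀ = ⌜ G ⌝. If G n₀ were positive, then n₀ ∉ Diagonal, so M
-- with P_n interpreted as n = n₀ would be a (T ⊔ T′)-model of φ ∧ P_n₀, contradicting e.
-- Hence G n₀ = 0, so n₀ ∈ Diagonal, and the model of φ ∧ P_n₀ promised by e satisfies
-- all freshness axioms: its T-reduct is an infinite model of φ.

module Submission where

open import Defs
open import Data.Bool using (true; false)
open import Data.Empty using (⊥; ⊥-elim)
open import Data.Fin using (Fin; zero; suc; #_; _↑ʳ_; toℕ)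
open import Data.Fin.Properties using (toℕ-injective)
open import Data.List using (List; []; _∷_; map)
open import Data.Nat hiding (_⊔_)
open import Data.Nat.Divisibility using (_∣_; divides; ∣m⇒∣m*n; *-cancelˡ-∣; m*n∣⇒m∣)
open import Data.Nat.Properties
open import Data.Nat.Solver using (module +-*-Solver)
open import Data.Product using (Σ; ∃; -,_; _×_; _,_; proj₁; proj₂)
open import Data.Product.Function.Dependent.Propositional using (Σ-⇔)
open import Data.Product.Function.NonDependent.Propositional using (_×-⇔_)
open import Data.Sum using (_⊎_; inj₁; inj₂; [_,_])
open import Data.Sum.Function.Propositional using (_⊎-⇔_)
open import Data.Sum.Properties using (inj₁-injective; inj₂-injective)
open import Data.Unit using (tt)
open import Data.Vec using (Vec; []; _∷_; head; tail; lookup; tabulate)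
open import Data.Vec.Properties using (tabulate∘lookup)
open import Function using (_∘_; id; const; _⇔_; mk⇔; Equivalence)
open import Function.Construct.Composition using (_⇔-∘_)
open import Function.Construct.Identity using (↠-id)
open import Function.Related.TypeIsomorphisms using (→-cong-⇔; ¬-cong-⇔)
open import Relation.Binary.Definitions using (tri<; tri≈; tri>)
open import Relation.Binary.PropositionalEquality hiding ([_])
open import Relation.Nullary using (¬_; contradiction; yes; no; Dec; ¬¬-excluded-middle)
open +-*-Solver using (solve; _:*_; _:=_)

Computable : (n : ℕ) → (Vec ℕ n → ℕ) → Set
Computable n f = Σ (μR n) λ p → ∀ xs → Eval p xs (f xs)

ComputableVec : (n m : ℕ) → (Vec ℕ n → Vec ℕ m) → Set
ComputableVec n m F = Σ (Vec (μR n) m) λ ps → ∀ xs → EvalVec ps xs (F xs)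

unary : (ℕ → ℕ) → Vec ℕ 1 → ℕ
unary f (x ∷ []) = f x

binary : (ℕ → ℕ → ℕ) → Vec ℕ 2 → ℕ
binary f (x ∷ y ∷ []) = f x y

succᶜ : Computable 1 (unary suc)
succᶜ = succ , λ { (x ∷ []) → e-succ }

module _ {n : ℕ} where

  resp-≗ : {f g : Vec ℕ n → ℕ} → f ≗ g → Computable n f → Computable n g
  resp-≗ f≗g (p , ev) = p , λ xs → subst (Eval p xs) (f≗g xs) (ev xs)

  []ᶜ : ComputableVec n 0 (λ _ → [])
  []ᶜ = [] , λ _ → ev-[]

  infixr 5 _∷ᶜ_
  _∷ᶜ_ : ∀ {m f F} → Computable n f → ComputableVec n m F →
         ComputableVec n (suc m) (λ xs → f xs ∷ F xs)
  (p , ev) ∷ᶜ (ps , evs) = p ∷ ps , λ xs → ev-∷ (ev xs) (evs xs)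

  compose : ∀ {m g F} → Computable m g → ComputableVec n m F → Computable n (g ∘ F)
  compose (p , ev) (ps , evs) = comp p ps , λ xs → e-comp (evs xs) (ev _)

  zeroᶜ : Computable n (λ _ → 0)
  zeroᶜ = zer , λ _ → e-zer

  projᶜ : (i : Fin n) → Computable n (λ xs → lookup xs i)
  projᶜ i = prj i , λ _ → e-prj

  lookups : ∀ {m} (sel : Fin m → Fin n) → ComputableVec n m (λ xs → tabulate (lookup xs ∘ sel))
  lookups {zero}  sel = []ᶜ
  lookups {suc m} sel = projᶜ (sel zero) ∷ᶜ lookups (sel ∘ suc)

  app₁ : ∀ {g f} → Computable 1 (unary g) → Computable n f → Computable n (λ xs → g (f xs))
  app₁ cg cf = compose cg (cf ∷ᶜ []ᶜ)

  app₂ : ∀ {g f₁ f₂} → Computable 2 (binary g) → Computable n f₁ → Computable n f₂ →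
         Computable n (λ xs → g (f₁ xs) (f₂ xs))
  app₂ cg c₁ c₂ = compose cg (c₁ ∷ᶜ c₂ ∷ᶜ []ᶜ)

  sucᶜ : ∀ {f} → Computable n f → Computable n (λ xs → suc (f xs))
  sucᶜ = app₁ succᶜ

  constᶜ : (k : ℕ) → Computable n (λ _ → k)
  constᶜ zero    = zeroᶜ
  constᶜ (suc k) = sucᶜ (constᶜ k)

primrecᶜ : ∀ {n g h} → Computable n g → Computable (2 + n) h → (f : ℕ → Vec ℕ n → ℕ) →
  (∀ xs → f 0 xs ≡ g xs) → (∀ k xs → f (suc k) xs ≡ h (k ∷ f k xs ∷ xs)) →
  Computable (suc n) (λ v → f (head v) (tail v))
primrecᶜ (pg , eg) (ph , eh) f f-zero f-suc = prec pg ph , λ { (k ∷ xs) → go k xs }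
  where
  go : ∀ k xs → Eval (prec pg ph) (k ∷ xs) (f k xs)
  go zero    xs = subst (Eval _ _) (sym (f-zero xs)) (e-rec0 (eg xs))
  go (suc k) xs = subst (Eval _ _) (sym (f-suc k xs)) (e-recS (go k xs) (eh _))

+-computable : Computable 2 (binary _+_)
+-computable = resp-≗ (λ { (x ∷ y ∷ []) → refl })
  (primrecᶜ (projᶜ zero) (sucᶜ (projᶜ (# 1))) (λ x v → x + head v)
    (λ { (y ∷ []) → refl }) (λ { _ (y ∷ []) → refl }))

*-computable : Computable 2 (binary _*_)
*-computable = resp-≗ (λ { (x ∷ y ∷ []) → refl })
  (primrecᶜ zeroᶜ (app₂ +-computable (projᶜ (# 2)) (projᶜ (# 1))) (λ x v → x * head v)
    (λ { (y ∷ []) → refl }) (λ { _ (y ∷ []) → refl }))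

pred-computable : Computable 1 (unary pred)
pred-computable = resp-≗ (λ { (x ∷ []) → refl })
  (primrecᶜ zeroᶜ (projᶜ zero) (λ x _ → pred x) (λ _ → refl) (λ _ _ → refl))

∸-computable : Computable 2 (binary _∸_)
∸-computable = resp-≗ (λ { (x ∷ y ∷ []) → refl }) (app₂ flipped (projᶜ (# 1)) (projᶜ (# 0)))
  where
  flipped : Computable 2 (binary λ y x → x ∸ y)
  flipped = resp-≗ (λ { (y ∷ x ∷ []) → refl })
    (primrecᶜ (projᶜ zero) (app₁ pred-computable (projᶜ (# 1))) (λ y v → head v ∸ y)
      (λ { (x ∷ []) → refl }) (λ { y (x ∷ []) → sym (pred[m∸n]≡m∸[1+n] x y) }))

^-computable : Computable 2 (binary _^_)
^-computable = resp-≗ (λ { (x ∷ y ∷ []) → refl }) (app₂ flipped (projᶜ (# 1)) (projᶜ (# 0)))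
  where
  flipped : Computable 2 (binary λ e b → b ^ e)
  flipped = resp-≗ (λ { (e ∷ b ∷ []) → refl })
    (primrecᶜ (constᶜ 1) (app₂ *-computable (projᶜ (# 2)) (projᶜ (# 1))) (λ e v → head v ^ e)
      (λ { (b ∷ []) → refl }) (λ { _ (b ∷ []) → refl }))

isZero : ℕ → ℕ
isZero zero    = 1
isZero (suc _) = 0

sg : ℕ → ℕ
sg zero    = 0
sg (suc _) = 1

isZero-computable : Computable 1 (unary isZero)
isZero-computable = resp-≗ (λ { (x ∷ []) → refl })
  (primrecᶜ (constᶜ 1) zeroᶜ (λ x _ → isZero x) (λ _ → refl) (λ _ _ → refl))

sg-computable : Computable 1 (unary sg)
sg-computable = resp-≗ (λ { (zero ∷ []) → refl ; (suc _ ∷ []) → refl })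
  (app₁ isZero-computable (app₁ isZero-computable (projᶜ zero)))

eqℕ : ℕ → ℕ → ℕ
eqℕ zero    zero    = 1
eqℕ zero    (suc _) = 0
eqℕ (suc _) zero    = 0
eqℕ (suc x) (suc y) = eqℕ x y

eqℕ-by-∸ : ∀ x y → eqℕ x y ≡ isZero ((x ∸ y) + (y ∸ x))
eqℕ-by-∸ zero    zero    = refl
eqℕ-by-∸ zero    (suc y) = refl
eqℕ-by-∸ (suc x) zero    = refl
eqℕ-by-∸ (suc x) (suc y) = eqℕ-by-∸ x y

eqℕ-computable : Computable 2 (binary eqℕ)
eqℕ-computable = resp-≗ (λ { (x ∷ y ∷ []) → sym (eqℕ-by-∸ x y) })
  (app₁ isZero-computable (app₂ +-computable (app₂ ∸-computable (projᶜ (# 0)) (projᶜ (# 1)))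
                                              (app₂ ∸-computable (projᶜ (# 1)) (projᶜ (# 0)))))

module _ {n : ℕ} where

  infixl 6 _+ᶜ_ _∸ᶜ_
  infixl 7 _*ᶜ_
  infixr 8 _^ᶜ_

  _+ᶜ_ : ∀ {f g} → Computable n f → Computable n g → Computable n (λ xs → f xs + g xs)
  _+ᶜ_ = app₂ +-computable

  _*ᶜ_ : ∀ {f g} → Computable n f → Computable n g → Computable n (λ xs → f xs * g xs)
  _*ᶜ_ = app₂ *-computable

  _∸ᶜ_ : ∀ {f g} → Computable n f → Computable n g → Computable n (λ xs → f xs ∸ g xs)
  _∸ᶜ_ = app₂ ∸-computable

  _^ᶜ_ : ∀ {f g} → Computable n f → Computable n g → Computable n (λ xs → f xs ^ g xs)
  _^ᶜ_ = app₂ ^-computable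

  isZeroᶜ : ∀ {f} → Computable n f → Computable n (λ xs → isZero (f xs))
  isZeroᶜ = app₁ isZero-computable

  predᶜ : ∀ {f} → Computable n f → Computable n (λ xs → pred (f xs))
  predᶜ = app₁ pred-computable

  sgᶜ : ∀ {f} → Computable n f → Computable n (λ xs → sg (f xs))
  sgᶜ = app₁ sg-computable

  eqℕᶜ : ∀ {f g} → Computable n f → Computable n g → Computable n (λ xs → eqℕ (f xs) (g xs))
  eqℕᶜ = app₂ eqℕ-computable

sumBelow : ℕ → (ℕ → ℕ) → ℕ
sumBelow zero    g = 0
sumBelow (suc k) g = sumBelow k g + g k

skipSecond : ∀ {n f} → Computable (suc n) f → Computable (2 + n) (λ v → f (head v ∷ tail (tail v)))
skipSecond {f = f} cf = resp-≗ dropSecond (compose cf (projᶜ zero ∷ᶜ lookups (2 ↑ʳ_)))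
  where
  dropSecond : ∀ v → f (lookup v zero ∷ tabulate (lookup v ∘ (2 ↑ʳ_))) ≡ f (head v ∷ tail (tail v))
  dropSecond (k ∷ _ ∷ xs) = cong (λ ys → f (k ∷ ys)) (tabulate∘lookup xs)

boundedSumᶜ : ∀ {n N f} → Computable n N → Computable (suc n) f →
  Computable n (λ xs → sumBelow (N xs) (λ i → f (i ∷ xs)))
boundedSumᶜ {n} {N} {f} cN cf =
  resp-≗ (λ xs → cong (λ ys → sumBelow (N xs) (λ i → f (i ∷ ys))) (tabulate∘lookup xs))
    (compose sumᶜ (cN ∷ᶜ lookups (λ i → i)))
  where
  sumᶜ : Computable (suc n) (λ v → sumBelow (head v) (λ i → f (i ∷ tail v)))
  sumᶜ = primrecᶜ zeroᶜ (projᶜ (# 1) +ᶜ skipSecond cf) (λ k xs → sumBelow k (λ i → f (i ∷ xs)))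
    (λ _ → refl) (λ _ _ → refl)

-- Primitive recursive, so that rem-computable is immediate; both are junk for y = 0.
rem : ℕ → ℕ → ℕ
rem zero    y = 0
rem (suc x) y = suc (rem x y) * sg (y ∸ suc (rem x y))

quot : ℕ → ℕ → ℕ
quot zero    y = 0
quot (suc x) y = quot x y + isZero (y ∸ suc (rem x y))

rem-quot-correct : ∀ {y} → 0 < y → ∀ x → rem x y < y × x ≡ rem x y + quot x y * y
rem-quot-correct y>0 zero = y>0 , refl
rem-quot-correct {y} y>0 (suc x) with rem-quot-correct y>0 x | y ∸ suc (rem x y) in gap
... | r<y , x≡r+qy | zero = subst (_< y) (sym (*-zeroʳ (suc r))) y>0 , (begin
  suc x                   ≡⟨ cong suc x≡r+qy ⟩
  suc r + q * y           ≡⟨ cong (_+ q * y) (trans (*-identityˡ y) y≡1+r) ⟨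
  1 * y + q * y           ≡⟨ +-comm (1 * y) (q * y) ⟩
  q * y + 1 * y           ≡⟨ *-distribʳ-+ y q 1 ⟨
  (q + 1) * y             ≡⟨ cong (_+ (q + 1) * y) (*-zeroʳ (suc r)) ⟨
  suc r * 0 + (q + 1) * y ∎)
  where
  open ≡-Reasoning
  r q : ℕ
  r = rem x y
  q = quot x y
  y≡1+r : y ≡ suc r
  y≡1+r = ≤-antisym (m∸n≡0⇒m≤n gap) r<y
... | r<y , x≡r+qy | suc _ =
  subst (_< y) (sym (*-identityʳ (suc (rem x y)))) (m∸n≢0⇒n<m (λ gap≡0 → 1+n≢0 (trans (sym gap) gap≡0))) ,
  (begin
  suc x                                 ≡⟨ cong suc x≡r+qy ⟩
  suc (rem x y) + quot x y * y
    ≡⟨ cong₂ (λ a b → a + b * y) (*-identityʳ (suc (rem x y))) (+-identityʳ (quot x y)) ⟨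
  suc (rem x y) * 1 + (quot x y + 0) * y ∎)
  where open ≡-Reasoning

smaller-quotient : ∀ {y r q r′ q′} → r < y → q < q′ → r + q * y < r′ + q′ * y
smaller-quotient {y} {r} {q} {r′} {q′} r<y q<q′ = begin-strict
  r + q * y   <⟨ +-monoˡ-< (q * y) r<y ⟩
  suc q * y   ≤⟨ *-monoˡ-≤ y q<q′ ⟩
  q′ * y      ≤⟨ m≤n+m (q′ * y) r′ ⟩
  r′ + q′ * y ∎
  where open ≤-Reasoning

division-unique : ∀ {y r q r′ q′} → r < y → r′ < y → r + q * y ≡ r′ + q′ * y → r ≡ r′ × q ≡ q′
division-unique {y} {r} {q} {r′} {q′} r<y r′<y eq with <-cmp q q′
... | tri< q<q′ _ _ = contradiction eq (<⇒≢ (smaller-quotient r<y q<q′))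
... | tri≈ _ refl _ = +-cancelʳ-≡ (q * y) r r′ eq , refl
... | tri> _ _ q′<q = contradiction (sym eq) (<⇒≢ (smaller-quotient r′<y q′<q))

rem-quot-unique : ∀ {x y r q} → r < y → x ≡ r + q * y → rem x y ≡ r × quot x y ≡ q
rem-quot-unique {x} r<y x≡r+qy with rem-quot-correct (m<n⇒0<n r<y) x
... | rem<y , x≡ = division-unique rem<y r<y (trans (sym x≡) x≡r+qy)

rem-quot-+-multiple : ∀ {y} → 0 < y → ∀ x k → rem (x + k * y) y ≡ rem x y × quot (x + k * y) y ≡ quot x y + k
rem-quot-+-multiple {y} y>0 x k with rem-quot-correct y>0 x
... | rem<y , x≡ = rem-quot-unique rem<y (begin
  x + k * y                         ≡⟨ cong (_+ k * y) x≡ ⟩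
  rem x y + quot x y * y + k * y    ≡⟨ +-assoc (rem x y) _ _ ⟩
  rem x y + (quot x y * y + k * y)  ≡⟨ cong (rem x y +_) (*-distribʳ-+ y (quot x y) k) ⟨
  rem x y + (quot x y + k) * y      ∎)
  where open ≡-Reasoning

digit : ℕ → ℕ → ℕ → ℕ
digit y x i = rem (quot x (y ^ i)) y

digit-below : ∀ {y} → 0 < y → ∀ {j L} → j < L → ∀ x z → digit y (x + y ^ L * z) j ≡ digit y x j
digit-below {y} y>0 {j} j<L x z with m≤n⇒∃[o]m+o≡n j<L
... | d , refl = begin
  rem (quot (x + y ^ suc (j + d) * z) (y ^ j)) y   ≡⟨ cong (λ t → rem (quot (x + t) (y ^ j)) y) shift ⟩
  rem (quot (x + y ^ d * z * y * y ^ j) (y ^ j)) y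
    ≡⟨ cong (λ t → rem t y) (proj₂ (rem-quot-+-multiple (m^n>0 y {{>-nonZero y>0}} j) x (y ^ d * z * y))) ⟩
  rem (quot x (y ^ j) + y ^ d * z * y) y           ≡⟨ proj₁ (rem-quot-+-multiple y>0 (quot x (y ^ j)) (y ^ d * z)) ⟩
  rem (quot x (y ^ j)) y                           ∎
  where
  open ≡-Reasoning
  shift : y ^ suc (j + d) * z ≡ y ^ d * z * y * y ^ j
  shift = begin
    y * y ^ (j + d) * z       ≡⟨ cong (λ t → y * t * z) (^-distribˡ-+-* y j d) ⟩
    y * (y ^ j * y ^ d) * z   ≡⟨ solve 4 (λ y a b z → y :* (a :* b) :* z := b :* z :* y :* a) refl y (y ^ j) (y ^ d) z ⟩
    y ^ d * z * y * y ^ j     ∎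

digit-at : ∀ {y L x z} → x < y ^ L → z < y → digit y (x + y ^ L * z) L ≡ z
digit-at {y} {L} {x} {z} x<yᴸ z<y = begin
  rem (quot (x + y ^ L * z) (y ^ L)) y
    ≡⟨ cong (λ t → rem t y) (proj₂ (rem-quot-unique {x + y ^ L * z} {q = z} x<yᴸ (cong (x +_) (*-comm (y ^ L) z)))) ⟩
  rem z y                              ≡⟨ proj₁ (rem-quot-unique {z} {q = 0} z<y (sym (+-identityʳ z))) ⟩
  z                                    ∎
  where open ≡-Reasoning

fromDigits : ℕ → (ℕ → ℕ) → ℕ → ℕ
fromDigits y w L = sumBelow L (λ i → y ^ i * w i)

module _ {y : ℕ} {w : ℕ → ℕ} where

  fromDigits-< : ∀ {L} → (∀ {i} → i < L → w i < y) → fromDigits y w L < y ^ L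
  fromDigits-< {zero}  _      = s≤s z≤n
  fromDigits-< {suc L} w<y = begin-strict
    fromDigits y w L + y ^ L * w L <⟨ +-monoˡ-< _ (fromDigits-< (w<y ∘ m<n⇒m<1+n)) ⟩
    y ^ L + y ^ L * w L            ≡⟨ *-suc (y ^ L) (w L) ⟨
    y ^ L * suc (w L)              ≤⟨ *-monoʳ-≤ (y ^ L) (w<y ≤-refl) ⟩
    y ^ L * y                      ≡⟨ *-comm (y ^ L) y ⟩
    y ^ suc L                      ∎
    where open ≤-Reasoning

  digit-fromDigits : ∀ {L} → (∀ {i} → i < L → w i < y) → ∀ {i} → i < L → digit y (fromDigits y w L) i ≡ w i
  digit-fromDigits {suc L} w<y {i} i<1+L with m<1+n⇒m<n∨m≡n i<1+L
  ... | inj₁ i<L  = trans (digit-below (m<n⇒0<n (w<y {L} ≤-refl)) i<L (fromDigits y w L) (w L))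
                          (digit-fromDigits (w<y ∘ m<n⇒m<1+n) i<L)
  ... | inj₂ refl = digit-at {L = L} (fromDigits-< (w<y ∘ m<n⇒m<1+n)) (w<y {L} ≤-refl)

rem-computable : Computable 2 (binary rem)
rem-computable = resp-≗ (λ { (x ∷ y ∷ []) → refl })
  (primrecᶜ zeroᶜ (sucᶜ (projᶜ (# 1)) *ᶜ sgᶜ (projᶜ (# 2) ∸ᶜ sucᶜ (projᶜ (# 1))))
    (λ x v → rem x (head v)) (λ _ → refl) (λ { _ (y ∷ []) → refl }))

quot-computable : Computable 2 (binary quot)
quot-computable = resp-≗ (λ { (x ∷ y ∷ []) → refl })
  (primrecᶜ zeroᶜ (projᶜ (# 1) +ᶜ isZeroᶜ (projᶜ (# 2) ∸ᶜ sucᶜ (app₂ rem-computable (projᶜ (# 0)) (projᶜ (# 2)))))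
    (λ x v → quot x (head v)) (λ _ → refl) (λ { _ (y ∷ []) → refl }))

module _ {n : ℕ} where

  remᶜ : ∀ {f g} → Computable n f → Computable n g → Computable n (λ xs → rem (f xs) (g xs))
  remᶜ = app₂ rem-computable

  quotᶜ : ∀ {f g} → Computable n f → Computable n g → Computable n (λ xs → quot (f xs) (g xs))
  quotᶜ = app₂ quot-computable

  digitᶜ : ∀ {f g h} → Computable n f → Computable n g → Computable n h →
           Computable n (λ xs → digit (f xs) (g xs) (h xs))
  digitᶜ cy cx ci = remᶜ (quotᶜ cx (cy ^ᶜ ci)) cy

rem≡0⇒∣ : ∀ {x y} → 0 < y → rem x y ≡ 0 → y ∣ x
rem≡0⇒∣ {x} {y} y>0 rem≡0 = divides (quot x y) (trans (proj₂ (rem-quot-correct y>0 x)) (cong (_+ quot x y * y) rem≡0))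

∣⇒rem≡0 : ∀ {x y} → 0 < y → y ∣ x → rem x y ≡ 0
∣⇒rem≡0 y>0 (divides q x≡qy) = proj₁ (rem-quot-unique {q = q} y>0 x≡qy)

odd∤ : ∀ b → ¬ 2 ∣ suc (2 * b)
odd∤ b (divides q eq) = even≢odd q b (trans (*-comm 2 q) (sym eq))

2^-∣-pair : ∀ {m a} b → m < a → 2 ^ suc m ∣ pair a b
2^-∣-pair {m} {a} b m<a = ∣m⇒∣m*n (suc (2 * b)) (divides (2 ^ (a ∸ suc m)) (begin
  2 ^ a                          ≡⟨ cong (2 ^_) (m+[n∸m]≡n m<a) ⟨
  2 ^ (suc m + (a ∸ suc m))      ≡⟨ ^-distribˡ-+-* 2 (suc m) (a ∸ suc m) ⟩
  2 ^ suc m * 2 ^ (a ∸ suc m)    ≡⟨ *-comm (2 ^ suc m) _ ⟩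
  2 ^ (a ∸ suc m) * 2 ^ suc m    ∎))
  where open ≡-Reasoning

2^-∤-pair : ∀ {m a} b → a ≤ m → ¬ 2 ^ suc m ∣ pair a b
2^-∤-pair {m} {a} b a≤m 2^1+m∣pair = odd∤ b (m*n∣⇒m∣ 2 (2 ^ (m ∸ a))
  (*-cancelˡ-∣ (2 ^ a) {{m^n≢0 2 a}} (subst (_∣ pair a b) split 2^1+m∣pair)))
  where
  open ≡-Reasoning
  split : 2 ^ suc m ≡ 2 ^ a * (2 * 2 ^ (m ∸ a))
  split = begin
    2 ^ suc m                  ≡⟨ cong (2 ^_) (trans (+-suc a (m ∸ a)) (cong suc (m+[n∸m]≡n a≤m))) ⟨
    2 ^ (a + suc (m ∸ a))      ≡⟨ ^-distribˡ-+-* 2 a (suc (m ∸ a)) ⟩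
    2 ^ a * (2 * 2 ^ (m ∸ a))  ∎

sumBelow-indicator : ∀ {a g} → (∀ {m} → m < a → g m ≡ 1) → (∀ {m} → a ≤ m → g m ≡ 0) →
  ∀ N → sumBelow N g ≡ N ⊓ a
sumBelow-indicator below above zero = refl
sumBelow-indicator {a} {g} below above (suc N) with N <? a
... | yes N<a = begin
  sumBelow N g + g N ≡⟨ cong₂ _+_ (sumBelow-indicator below above N) (below N<a) ⟩
  N ⊓ a + 1          ≡⟨ cong (_+ 1) (m≤n⇒m⊓n≡m (<⇒≤ N<a)) ⟩
  N + 1              ≡⟨ +-comm N 1 ⟩
  suc N              ≡⟨ m≤n⇒m⊓n≡m N<a ⟨
  suc N ⊓ a          ∎
  where open ≡-Reasoning
... | no N≮a = begin
  sumBelow N g + g N ≡⟨ cong₂ _+_ (sumBelow-indicator below above N) (above (≮⇒≥ N≮a)) ⟩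
  N ⊓ a + 0          ≡⟨ +-identityʳ (N ⊓ a) ⟩
  N ⊓ a              ≡⟨ m≥n⇒m⊓n≡n (≮⇒≥ N≮a) ⟩
  a                  ≡⟨ m≥n⇒m⊓n≡n (m≤n⇒m≤1+n (≮⇒≥ N≮a)) ⟨
  suc N ⊓ a          ∎
  where open ≡-Reasoning

-- The 2-adic valuation, counted as the number of m < x with 2 ^ (m + 1) ∣ x.
unpair₁ : ℕ → ℕ
unpair₁ x = sumBelow x (λ m → isZero (rem x (2 ^ suc m)))

unpair₂ : ℕ → ℕ
unpair₂ x = quot (quot x (2 ^ unpair₁ x)) 2

n<2^n : ∀ n → n < 2 ^ n
n<2^n zero    = s≤s z≤n
n<2^n (suc n) = +-mono-≤ (m^n>0 2 n) (≤-trans (n<2^n n) (m≤m+n (2 ^ n) 0))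

<-pairˡ : ∀ a b → a < pair a b
<-pairˡ a b = ≤-trans (n<2^n a) (m≤m*n (2 ^ a) (suc (2 * b)))

<-pairʳ : ∀ a b → b < pair a b
<-pairʳ a b = ≤-trans (s≤s (m≤m+n b (b + 0))) (m≤n*m (suc (2 * b)) (2 ^ a) {{m^n≢0 2 a}})

half-odd : ∀ b → quot (suc (2 * b)) 2 ≡ b
half-odd b = proj₂ (rem-quot-unique {q = b} (s≤s (s≤s z≤n)) (cong suc (*-comm 2 b)))

unpair₁-pair : ∀ a b → unpair₁ (pair a b) ≡ a
unpair₁-pair a b = trans (sumBelow-indicator divisible indivisible (pair a b)) (m≥n⇒m⊓n≡n (<⇒≤ (<-pairˡ a b)))
  where
  divisible : ∀ {m} → m < a → isZero (rem (pair a b) (2 ^ suc m)) ≡ 1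
  divisible {m} m<a = cong isZero (∣⇒rem≡0 (m^n>0 2 (suc m)) (2^-∣-pair b m<a))
  indivisible : ∀ {m} → a ≤ m → isZero (rem (pair a b) (2 ^ suc m)) ≡ 0
  indivisible {m} a≤m with rem (pair a b) (2 ^ suc m) in rem≡
  ... | zero  = contradiction (rem≡0⇒∣ (m^n>0 2 (suc m)) rem≡) (2^-∤-pair b a≤m)
  ... | suc _ = refl

unpair₂-pair : ∀ a b → unpair₂ (pair a b) ≡ b
unpair₂-pair a b = begin
  quot (quot (pair a b) (2 ^ unpair₁ (pair a b))) 2
    ≡⟨ cong (λ e → quot (quot (pair a b) (2 ^ e)) 2) (unpair₁-pair a b) ⟩
  quot (quot (pair a b) (2 ^ a)) 2                  ≡⟨ cong (λ t → quot t 2) odd-part ⟩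
  quot (suc (2 * b)) 2                              ≡⟨ half-odd b ⟩
  b                                                 ∎
  where
  open ≡-Reasoning
  odd-part : quot (pair a b) (2 ^ a) ≡ suc (2 * b)
  odd-part = proj₂ (rem-quot-unique {q = suc (2 * b)} (m^n>0 2 a) (*-comm (2 ^ a) _))

pair-injective : ∀ a b a′ b′ → pair a b ≡ pair a′ b′ → a ≡ a′ × b ≡ b′
pair-injective a b a′ b′ eq =
  trans (sym (unpair₁-pair a b)) (trans (cong unpair₁ eq) (unpair₁-pair a′ b′)) ,
  trans (sym (unpair₂-pair a b)) (trans (cong unpair₂ eq) (unpair₂-pair a′ b′))

module _ {n : ℕ} where

  pairᶜ : ∀ {f g} → Computable n f → Computable n g → Computable n (λ xs → pair (f xs) (g xs))
  pairᶜ ca cb = (constᶜ 2 ^ᶜ ca) *ᶜ sucᶜ (constᶜ 2 *ᶜ cb)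

  unpair₁ᶜ : ∀ {f} → Computable n f → Computable n (λ xs → unpair₁ (f xs))
  unpair₁ᶜ = app₁ (resp-≗ (λ { (x ∷ []) → refl })
    (boundedSumᶜ (projᶜ zero) (isZeroᶜ (remᶜ (projᶜ (# 1)) (constᶜ 2 ^ᶜ sucᶜ (projᶜ (# 0)))))))

  unpair₂ᶜ : ∀ {f} → Computable n f → Computable n (λ xs → unpair₂ (f xs))
  unpair₂ᶜ cx = quotᶜ (quotᶜ cx (constᶜ 2 ^ᶜ unpair₁ᶜ cx)) (constᶜ 2)

<-pair-pairˡ : ∀ t k l → k < pair t (pair k l)
<-pair-pairˡ t k l = <-trans (<-pairˡ k l) (<-pairʳ t (pair k l))

<-pair-pairʳ : ∀ t k l → l < pair t (pair k l)
<-pair-pairʳ t k l = <-trans (<-pairʳ k l) (<-pairʳ t (pair k l))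

select : ℕ → List ℕ → ℕ
select _       []       = 0
select zero    (v ∷ vs) = v
select (suc t) (v ∷ vs) = select t vs

select-∷ : ∀ t v vs → select t (v ∷ vs) ≡ isZero t * v + sg t * select (pred t) vs
select-∷ zero    v vs = sym (trans (+-identityʳ (v + 0)) (+-identityʳ v))
select-∷ (suc t) v vs = sym (+-identityʳ (select t vs))

selectᶜ : ∀ {n t} → Computable n t → (cs : List (Σ (Vec ℕ n → ℕ) (Computable n))) →
  Computable n (λ xs → select (t xs) (map (λ c → proj₁ c xs) cs))
selectᶜ ct []              = zeroᶜ
selectᶜ {t = t} ct ((f , cf) ∷ cs) =
  resp-≗ (λ xs → sym (select-∷ (t xs) (f xs) _)) (isZeroᶜ ct *ᶜ cf +ᶜ sgᶜ ct *ᶜ selectᶜ (predᶜ ct) cs)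

-- The values at all j′ < j are stored as the binary digits of history j, so value
-- is primitive recursive in step; digit-history needs step to produce bits.
module CourseOfValues {n : ℕ} (step : Vec ℕ (2 + n) → ℕ) where

  history : Vec ℕ n → ℕ → ℕ
  history xs zero    = 0
  history xs (suc j) = history xs j + 2 ^ j * step (j ∷ history xs j ∷ xs)

  value : Vec ℕ n → ℕ → ℕ
  value xs j = step (j ∷ history xs j ∷ xs)

  history≡fromDigits : ∀ xs j → history xs j ≡ fromDigits 2 (value xs) j
  history≡fromDigits xs zero    = refl
  history≡fromDigits xs (suc j) = cong (_+ 2 ^ j * value xs j) (history≡fromDigits xs j)

  digit-history : (∀ v → step v < 2) → ∀ xs {j k} → k < j → digit 2 (history xs j) k ≡ value xs k
  digit-history step<2 xs {j} {k} k<j =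
    trans (cong (λ h → digit 2 h k) (history≡fromDigits xs j)) (digit-fromDigits (λ _ → step<2 _) k<j)

  valueᶜ : Computable (2 + n) step → Computable (suc n) (λ v → value (tail v) (head v))
  valueᶜ cstep = resp-≗ (λ { (j ∷ xs) → cong (λ ys → step (j ∷ history xs j ∷ ys)) (tabulate∘lookup xs) })
    (compose cstep (projᶜ zero ∷ᶜ historyᶜ ∷ᶜ lookups (1 ↑ʳ_)))
    where
    historyᶜ : Computable (suc n) (λ v → history (tail v) (head v))
    historyᶜ = primrecᶜ zeroᶜ (projᶜ (# 1) +ᶜ (constᶜ 2 ^ᶜ projᶜ (# 0)) *ᶜ cstep) (λ j xs → history xs j)
      (λ _ → refl) (λ _ _ → refl)

mutual
  Eval-deterministic : ∀ {n} {p : μR n} {xs y y′} → Eval p xs y → Eval p xs y′ → y ≡ y′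
  Eval-deterministic e-zer e-zer = refl
  Eval-deterministic e-succ e-succ = refl
  Eval-deterministic e-prj e-prj = refl
  Eval-deterministic (e-comp gs f) (e-comp gs′ f′) with EvalVec-deterministic gs gs′
  ... | refl = Eval-deterministic f f′
  Eval-deterministic (e-rec0 g) (e-rec0 g′) = Eval-deterministic g g′
  Eval-deterministic (e-recS r h) (e-recS r′ h′) with Eval-deterministic r r′
  ... | refl = Eval-deterministic h h′
  Eval-deterministic (e-mini {k = k} zero-at-k below-k) (e-mini {k = k′} zero-at-k′ below-k′) with <-cmp k k′
  ... | tri< k<k′ _ _ = contradiction (Eval-deterministic zero-at-k (proj₂ (below-k′ k k<k′))) λ ()
  ... | tri≈ _ k≡k′ _ = k≡k′
  ... | tri> _ _ k′<k = contradiction (Eval-deterministic (proj₂ (below-k k′ k′<k)) zero-at-k′) λ ()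

  EvalVec-deterministic : ∀ {n m} {ps : Vec (μR n) m} {xs ys ys′} → EvalVec ps xs ys → EvalVec ps xs ys′ → ys ≡ ys′
  EvalVec-deterministic ev-[] ev-[] = refl
  EvalVec-deterministic (ev-∷ e es) (ev-∷ e′ es′) =
    cong₂ _∷_ (Eval-deterministic e e′) (EvalVec-deterministic es es′)

-- Opaque: only injectivity is used, and unfolding the code of a concrete program
-- makes the type checker compute towers of exponentials.
opaque
  tag : ∀ {n} → μR n → ℕ
  tag zer        = 0
  tag succ       = 1
  tag (prj _)    = 2
  tag (comp _ _) = 3
  tag (prec _ _) = 4
  tag (mini _)   = 5

  mutual
    fields : ∀ {n} → μR n → ℕ
    fields zer                 = 0
    fields succ                = 0
    fields (prj i)             = toℕ i
    fields (comp {m = m} f gs) = pair m (pair ⌜ f ⌝ ⌜ gs ⌝ᵛ)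
    fields (prec g h)          = pair ⌜ g ⌝ ⌜ h ⌝
    fields (mini f)            = ⌜ f ⌝

    ⌜_⌝ : ∀ {n} → μR n → ℕ
    ⌜ p ⌝ = pair (tag p) (fields p)

    ⌜_⌝ᵛ : ∀ {n m} → Vec (μR n) m → ℕ
    ⌜ [] ⌝ᵛ     = 0
    ⌜ g ∷ gs ⌝ᵛ = suc (pair ⌜ g ⌝ ⌜ gs ⌝ᵛ)

  mutual
    ⌜⌝-injective : ∀ {n} (p q : μR n) → ⌜ p ⌝ ≡ ⌜ q ⌝ → p ≡ q
    ⌜⌝-injective p q eq = same-shape p q (pair-injective (tag p) (fields p) (tag q) (fields q) eq)

    ⌜⌝ᵛ-injective : ∀ {n m} (gs hs : Vec (μR n) m) → ⌜ gs ⌝ᵛ ≡ ⌜ hs ⌝ᵛ → gs ≡ hs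
    ⌜⌝ᵛ-injective [] [] _ = refl
    ⌜⌝ᵛ-injective (g ∷ gs) (h ∷ hs) eq with pair-injective ⌜ g ⌝ ⌜ gs ⌝ᵛ ⌜ h ⌝ ⌜ hs ⌝ᵛ (suc-injective eq)
    ... | g≡h , gs≡hs = cong₂ _∷_ (⌜⌝-injective g h g≡h) (⌜⌝ᵛ-injective gs hs gs≡hs)

    same-shape : ∀ {n} (p q : μR n) → tag p ≡ tag q × fields p ≡ fields q → p ≡ q
    same-shape zer  zer  _ = refl
    same-shape succ succ _ = refl
    same-shape (prj i) (prj j) (_ , eq) = cong prj (toℕ-injective eq)
    same-shape (comp {m = m} f gs) (comp {m = m′} f′ gs′) (_ , eq)
      with pair-injective m (pair ⌜ f ⌝ ⌜ gs ⌝ᵛ) m′ (pair ⌜ f′ ⌝ ⌜ gs′ ⌝ᵛ) eq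
    ... | refl , eq′ with pair-injective ⌜ f ⌝ ⌜ gs ⌝ᵛ ⌜ f′ ⌝ ⌜ gs′ ⌝ᵛ eq′
    ... | f≡f′ , gs≡gs′ with ⌜⌝-injective f f′ f≡f′ | ⌜⌝ᵛ-injective gs gs′ gs≡gs′
    ... | refl | refl = refl
    same-shape (prec g h) (prec g′ h′) (_ , eq) with pair-injective ⌜ g ⌝ ⌜ h ⌝ ⌜ g′ ⌝ ⌜ h′ ⌝ eq
    ... | g≡g′ , h≡h′ = cong₂ prec (⌜⌝-injective g g′ g≡g′) (⌜⌝-injective h h′ h≡h′)
    same-shape (mini f) (mini f′) (_ , eq) = cong mini (⌜⌝-injective f f′ eq)
    same-shape zer        succ       (() , _)
    same-shape zer        (prj _)    (() , _)
    same-shape zer        (comp _ _) (() , _)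
    same-shape zer        (prec _ _) (() , _)
    same-shape zer        (mini _)   (() , _)
    same-shape succ       zer        (() , _)
    same-shape succ       (prj _)    (() , _)
    same-shape succ       (comp _ _) (() , _)
    same-shape succ       (prec _ _) (() , _)
    same-shape succ       (mini _)   (() , _)
    same-shape (prj _)    zer        (() , _)
    same-shape (prj _)    succ       (() , _)
    same-shape (prj _)    (comp _ _) (() , _)
    same-shape (prj _)    (prec _ _) (() , _)
    same-shape (prj _)    (mini _)   (() , _)
    same-shape (comp _ _) zer        (() , _)
    same-shape (comp _ _) succ       (() , _)
    same-shape (comp _ _) (prj _)    (() , _)
    same-shape (comp _ _) (prec _ _) (() , _)
    same-shape (comp _ _) (mini _)   (() , _)
    same-shape (prec _ _) zer        (() , _)
    same-shape (prec _ _) succ       (() , _)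
    same-shape (prec _ _) (prj _)    (() , _)
    same-shape (prec _ _) (comp _ _) (() , _)
    same-shape (prec _ _) (mini _)   (() , _)
    same-shape (mini _)   zer        (() , _)
    same-shape (mini _)   succ       (() , _)
    same-shape (mini _)   (prj _)    (() , _)
    same-shape (mini _)   (comp _ _) (() , _)
    same-shape (mini _)   (prec _ _) (() , _)

Diagonal : ℕ → Set
Diagonal n = ∀ (p : μR 1) → ⌜ p ⌝ ≡ n → ∀ b → Eval p (n ∷ []) b → b ≡ 0

diagonal-zero : ∀ (p : μR 1) → Eval p (⌜ p ⌝ ∷ []) 0 → Diagonal ⌜ p ⌝
diagonal-zero p ev q ⌜q⌝≡⌜p⌝ b ev′ with ⌜⌝-injective q p ⌜q⌝≡⌜p⌝
... | refl = Eval-deterministic ev′ ev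

diagonal-suc : ∀ (p : μR 1) {b} → Eval p (⌜ p ⌝ ∷ []) (suc b) → ¬ Diagonal ⌜ p ⌝
diagonal-suc p {b} ev diag = contradiction (diag p refl (suc b) ev) λ ()

update-same : ∀ {A : Set} (a : Var → A) x d → update a x d x ≡ d
update-same a x d with x ≡ᵇ x | ≡⇒≡ᵇ x x refl
... | true | _ = refl

update-other : ∀ {A : Set} (a : Var → A) {x} d {y} → y ≢ x → update a x d y ≡ a y
update-other a {x} d {y} y≢x with y ≡ᵇ x | ≡ᵇ⇒≡ y x
... | true  | ≡ᵇ⇒y≡x = contradiction (≡ᵇ⇒y≡x tt) y≢x
... | false | _       = refl

FreshBeyond : ℕ → Set → Set
FreshBeyond k D = ∀ (e : ℕ → D) → Σ D λ d → ∀ {i} → i < k → d ≢ e i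

module _ {D : Set} (d₀ : D) (fresh : ∀ k → FreshBeyond k D) where

  private
    enumeration : ℕ → ℕ → D
    enumeration zero    _ = d₀
    enumeration (suc m) i with i ≟ m
    ... | yes _ = proj₁ (fresh m (enumeration m))
    ... | no _  = enumeration m i

    element : ℕ → D
    element m = proj₁ (fresh m (enumeration m))

    enumeration-stable : ∀ {m i} → i < m → enumeration m i ≡ element i
    enumeration-stable {suc m} {i} i<1+m with i ≟ m
    ... | yes refl = refl
    ... | no i≢m   = enumeration-stable (≤∧≢⇒< (≤-pred i<1+m) i≢m)

    element-injective : ∀ {i j} → element i ≡ element j → i ≡ j
    element-injective {i} {j} eq with <-cmp i j
    ... | tri< i<j _ _ = contradiction (trans (sym eq) (sym (enumeration-stable i<j))) (proj₂ (fresh j (enumeration j)) i<j)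
    ... | tri≈ _ i≡j _ = i≡j
    ... | tri> _ _ j<i = contradiction (trans eq (sym (enumeration-stable j<i))) (proj₂ (fresh i (enumeration i)) j<i)

  fresh⇒infinite : Infinite D
  fresh⇒infinite = element , element-injective

≤-sumBelow : ∀ {k} (g : ℕ → ℕ) {i} → i < k → g i ≤ sumBelow k g
≤-sumBelow {suc k} g {i} i<1+k with m<1+n⇒m<n∨m≡n i<1+k
... | inj₁ i<k  = ≤-trans (≤-sumBelow g i<k) (m≤m+n (sumBelow k g) (g k))
... | inj₂ refl = m≤n+m (g k) (sumBelow k g)

fresh-ℕ : ∀ k → FreshBeyond k ℕ
fresh-ℕ k e = suc (sumBelow k e) , λ i<k eq → 1+n≰n (≤-trans (≤-reflexive eq) (≤-sumBelow e i<k))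

fresh-⊎ℕ : ∀ {X : Set} k → FreshBeyond k (X ⊎ ℕ)
fresh-⊎ℕ k e with fresh-ℕ k ([ const 0 , id ] ∘ e)
... | n , n-fresh = inj₂ n , λ i<k eq → n-fresh i<k (cong [ const 0 , id ] eq)

S′ : Signature
S′ = record
  { Fun = ⊥ ; Rel = ℕ ; farity = λ () ; rarity = λ _ → 0
  ; fcode = λ () ; rcode = λ n → n ; fcode-inj = λ {x} → ⊥-elim x ; rcode-inj = λ eq → eq }

distinctFromAll : Var → ℕ → Formula S′
distinctFromAll x zero    = ¬' ⊥'
distinctFromAll x (suc m) = distinctFromAll x m ∧' (¬' (var x ≐ var m))

∀-block : ∀ {S} → ℕ → Var → Formula S → Formula S
∀-block zero    s φ = φ
∀-block (suc l) s φ = ∀' s (∀-block l (suc s) φ)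

freshAxiom : ℕ → Formula S′
freshAxiom k = ∀-block k 0 (∃' k (distinctFromAll k k))

free-distinctFromAll : ∀ {y} x m → FreeIn y (distinctFromAll x m) → y ≡ x ⊎ y < m
free-distinctFromAll x zero (f-¬ ())
free-distinctFromAll x (suc m) (f-∧ˡ free) with free-distinctFromAll x m free
... | inj₁ y≡x = inj₁ y≡x
... | inj₂ y<m = inj₂ (m<n⇒m<1+n y<m)
free-distinctFromAll x (suc m) (f-∧ʳ (f-¬ (f-≐ˡ o-var))) = inj₁ refl
free-distinctFromAll x (suc m) (f-∧ʳ (f-¬ (f-≐ʳ o-var))) = inj₂ ≤-refl

free-∀-block : ∀ {S} {y} l s (φ : Formula S) → FreeIn y (∀-block l s φ) → FreeIn y φ × (s ≤ y → s + l ≤ y)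
free-∀-block zero    s φ free = free , λ s≤y → subst (_≤ _) (sym (+-identityʳ s)) s≤y
free-∀-block {y = y} (suc l) s φ (f-∀ y≢s free) with free-∀-block l (suc s) φ free
... | free-φ , outside = free-φ , λ s≤y → subst (_≤ y) (sym (+-suc s l)) (outside (≤∧≢⇒< s≤y (y≢s ∘ sym)))

freshAxiom-sentence : ∀ k → Sentence (freshAxiom k)
freshAxiom-sentence k y free with free-∀-block k 0 _ free
... | f-∃ y≢k free-body , outside with free-distinctFromAll k k free-body
... | inj₁ y≡k = y≢k y≡k
... | inj₂ y<k = <⇒≱ y<k (outside z≤n)

module _ {S} (M : Structure S) where

  overwrite : Assignment M → (ℕ → D M) → Var → ℕ → Assignment M
  overwrite a e s zero    = a
  overwrite a e s (suc l) = overwrite (update a s (e s)) e (suc s) l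

  overwrite-below : ∀ a e {s} l {i} → i < s → overwrite a e s l i ≡ a i
  overwrite-below a e zero    i<s = refl
  overwrite-below a e {s} (suc l) i<s =
    trans (overwrite-below _ e l (m<n⇒m<1+n i<s)) (update-other a (e s) (<⇒≢ i<s))

  overwrite-inside : ∀ a e {s} l {i} → s ≤ i → i < s + l → overwrite a e s l i ≡ e i
  overwrite-inside a e {s} zero    s≤i i<s+0 = contradiction (subst (_ <_) (+-identityʳ s) i<s+0) (≤⇒≯ s≤i)
  overwrite-inside a e {s} (suc l) {i} s≤i i<s+1+l with m≤n⇒m<n∨m≡n s≤i
  ... | inj₁ s<i  = overwrite-inside _ e l s<i (subst (i <_) (+-suc s l) i<s+1+l)
  ... | inj₂ refl = trans (overwrite-below _ e l ≤-refl) (update-same a s (e s))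

  ∀-block-intro : ∀ {φ} → (∀ b → M , b ⊨ φ) → ∀ l s a → M , a ⊨ ∀-block l s φ
  ∀-block-intro valid zero    s a = valid a
  ∀-block-intro valid (suc l) s a = λ d → ∀-block-intro valid l (suc s) (update a s d)

  ∀-block-elim : ∀ {φ} l s a → M , a ⊨ ∀-block l s φ → ∀ e → M , overwrite a e s l ⊨ φ
  ∀-block-elim zero    s a sat e = sat
  ∀-block-elim (suc l) s a sat e = ∀-block-elim l (suc s) _ (sat (e s)) e

module _ (M : Structure S′) where

  ⊨distinctFromAll⇔ : ∀ a x m → M , a ⊨ distinctFromAll x m ⇔ (∀ {i} → i < m → a x ≢ a i)
  ⊨distinctFromAll⇔ a x zero    = mk⇔ (λ _ ()) (λ _ ())
  ⊨distinctFromAll⇔ a x (suc m) = mk⇔ to from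
    where
    IH : M , a ⊨ distinctFromAll x m ⇔ (∀ {i} → i < m → a x ≢ a i)
    IH = ⊨distinctFromAll⇔ a x m
    to : M , a ⊨ distinctFromAll x (suc m) → ∀ {i} → i < suc m → a x ≢ a i
    to (sat , x≢m) i<1+m with m<1+n⇒m<n∨m≡n i<1+m
    ... | inj₁ i<m  = Equivalence.to IH sat i<m
    ... | inj₂ refl = x≢m
    from : (∀ {i} → i < suc m → a x ≢ a i) → M , a ⊨ distinctFromAll x (suc m)
    from distinct = Equivalence.from IH (distinct ∘ m<n⇒m<1+n) , distinct ≤-refl

  freshAxiom-intro : ∀ {k} → FreshBeyond k (D M) → ∀ a → M , a ⊨ freshAxiom k
  freshAxiom-intro {k} fresh = ∀-block-intro M witness k 0
    where
    witness : ∀ b → M , b ⊨ ∃' k (distinctFromAll k k)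
    witness b with fresh b
    ... | d , d-fresh = d , Equivalence.from (⊨distinctFromAll⇔ _ k k) λ {i} i<k →
      subst₂ _≢_ (sym (update-same b k d)) (sym (update-other b d (<⇒≢ i<k))) (d-fresh i<k)

  freshAxiom-elim : ∀ {k} a → M , a ⊨ freshAxiom k → FreshBeyond k (D M)
  freshAxiom-elim {k} a sat e with ∀-block-elim M k 0 a sat e
  ... | d , distinct = d , λ {i} i<k →
    subst₂ _≢_ (update-same b k d) (trans (update-other b d (<⇒≢ i<k)) (overwrite-inside M a e k z≤n i<k))
      (Equivalence.to (⊨distinctFromAll⇔ _ k k) distinct i<k)
    where
    b : Assignment M
    b = overwrite M a e 0 k

data T′-Axiom : Formula S′ → Set where
  diagonal⇒fresh : ∀ {m} k → Diagonal m → T′-Axiom (rel m [] ⇒' freshAxiom k)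

T′ : Theory S′
T′ = record { Ax = T′-Axiom ; Ax-sentence = sentence }
  where
  sentence : ∀ φ → T′-Axiom φ → Sentence φ
  sentence _ (diagonal⇒fresh k _) y (f-⇒ˡ (f-r ()))
  sentence _ (diagonal⇒fresh k _) y (f-⇒ʳ free) = freshAxiom-sentence k y free

module _ (M : Structure S′) where

  fresh⇒T′-model : (∀ k → FreshBeyond k (D M)) → ∀ a → IsModel T′ M a
  fresh⇒T′-model fresh a _ (diagonal⇒fresh k _) _ = freshAxiom-intro M (fresh k) a

  T′-model-without-diagonal-atoms : (∀ {m} → Diagonal m → ¬ rel' M m []) → ∀ a → IsModel T′ M a
  T′-model-without-diagonal-atoms no-atom a _ (diagonal⇒fresh k diag) atom = contradiction atom (no-atom diag)

  T′-model⇒fresh : ∀ {a m} → IsModel T′ M a → Diagonal m → rel' M m [] → ∀ k → FreshBeyond k (D M)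
  T′-model⇒fresh {a} model diag atom k = freshAxiom-elim M a (model _ (diagonal⇒fresh k diag) atom)

record Agree (c : ℕ) (M N : Structure S′) (a : Assignment M) (b : Assignment N) : Set where
  field
    ≡-agree   : ∀ {i j} → i < c → j < c → a i ≡ a j ⇔ b i ≡ b j
    rel-agree : ∀ {n} → n < c → rel' M n [] ⇔ rel' N n []

⊨-transfer : ∀ {c M N a b} → Agree c M N a b → ∀ φ → QF φ → code φ ≤ c → M , a ⊨ φ ⇔ N , b ⊨ φ
⊨-transfer agree ⊥' qf-⊥ _ = mk⇔ id id
⊨-transfer agree (var i ≐ var j) qf-≐ ≤c = Agree.≡-agree agree
  (<-≤-trans (<-trans (<-pairʳ 0 i) (<-pair-pairˡ 1 (pair 0 i) (pair 0 j))) ≤c)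
  (<-≤-trans (<-trans (<-pairʳ 0 j) (<-pair-pairʳ 1 (pair 0 i) (pair 0 j))) ≤c)
⊨-transfer agree (var _ ≐ app () _) qf-≐ _
⊨-transfer agree (app () _ ≐ _) qf-≐ _
⊨-transfer agree (rel n []) qf-r ≤c = Agree.rel-agree agree (<-≤-trans (<-pair-pairˡ 2 n 0) ≤c)
⊨-transfer agree (¬' φ) (qf-¬ q) ≤c =
  ¬-cong-⇔ (⊨-transfer agree φ q (<⇒≤ (<-≤-trans (<-pairʳ 3 (code φ)) ≤c)))
⊨-transfer agree (φ ∧' ψ) (qf-∧ q q′) ≤c =
  ⊨-transfer agree φ q (<⇒≤ (<-≤-trans (<-pair-pairˡ 4 (code φ) (code ψ)) ≤c)) ×-⇔
  ⊨-transfer agree ψ q′ (<⇒≤ (<-≤-trans (<-pair-pairʳ 4 (code φ) (code ψ)) ≤c))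
⊨-transfer agree (φ ∨' ψ) (qf-∨ q q′) ≤c =
  ⊨-transfer agree φ q (<⇒≤ (<-≤-trans (<-pair-pairˡ 5 (code φ) (code ψ)) ≤c)) ⊎-⇔
  ⊨-transfer agree ψ q′ (<⇒≤ (<-≤-trans (<-pair-pairʳ 5 (code φ) (code ψ)) ≤c))
⊨-transfer agree (φ ⇒' ψ) (qf-⇒ q q′) ≤c = →-cong-⇔
  (⊨-transfer agree φ q (<⇒≤ (<-≤-trans (<-pair-pairˡ 6 (code φ) (code ψ)) ≤c)))
  (⊨-transfer agree ψ q′ (<⇒≤ (<-≤-trans (<-pair-pairʳ 6 (code φ) (code ψ)) ≤c)))

_⊎ℕ : Structure S′ → Structure S′
M ⊎ℕ = record { D = D M ⊎ ℕ ; fun = λ () ; rel' = λ n _ → rel' M n [] }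

T′-stablyInfinite : StablyInfinite T′
T′-stablyInfinite φ qf (M , a , _ , sat) =
  M ⊎ℕ , (inj₂ , inj₂-injective) , inj₁ ∘ a , fresh⇒T′-model (M ⊎ℕ) fresh-⊎ℕ (inj₁ ∘ a) ,
  Equivalence.to (⊨-transfer agree φ qf ≤-refl) sat
  where
  agree : Agree (code φ) M (M ⊎ℕ) a (inj₁ ∘ a)
  agree = record { ≡-agree = λ _ _ → mk⇔ (cong inj₁) inj₁-injective ; rel-agree = λ _ → mk⇔ id id }

sg<2 : ∀ x → sg x < 2
sg<2 zero    = s≤s z≤n
sg<2 (suc _) = s≤s (s≤s z≤n)

≡sg⇒≢0⇔ : ∀ {a x} → a ≡ sg x → a ≢ 0 ⇔ x ≢ 0
≡sg⇒≢0⇔ {x = zero}  refl = mk⇔ id id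
≡sg⇒≢0⇔ {x = suc _} refl = mk⇔ (λ _ ()) (λ _ ())

isZero≢0⇔ : ∀ x → isZero x ≢ 0 ⇔ (¬ x ≢ 0)
isZero≢0⇔ zero    = mk⇔ (λ _ 0≢0 → 0≢0 refl) (λ _ ())
isZero≢0⇔ (suc _) = mk⇔ (λ 0≢0 → contradiction refl 0≢0) (λ ¬1+x≢0 → contradiction (λ ()) ¬1+x≢0)

*≢0⇔ : ∀ x y → x * y ≢ 0 ⇔ (x ≢ 0 × y ≢ 0)
*≢0⇔ zero    y       = mk⇔ (λ 0≢0 → contradiction refl 0≢0) proj₁
*≢0⇔ (suc x) zero    = mk⇔ (contradiction (*-zeroʳ x)) (λ (_ , 0≢0) → contradiction refl 0≢0)
*≢0⇔ (suc x) (suc y) = mk⇔ (λ _ → (λ ()) , (λ ())) (λ _ ())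

+≢0⇔ : ∀ x y → x + y ≢ 0 ⇔ (x ≢ 0 ⊎ y ≢ 0)
+≢0⇔ zero    y = mk⇔ inj₂ [ (λ 0≢0 → contradiction refl 0≢0) , id ]
+≢0⇔ (suc x) y = mk⇔ (λ _ → inj₁ λ ()) (λ _ ())

isZero+≢0⇔ : ∀ x y → isZero x + y ≢ 0 ⇔ (x ≢ 0 → y ≢ 0)
isZero+≢0⇔ zero    y = mk⇔ (λ _ 0≢0 → contradiction refl 0≢0) (λ _ ())
isZero+≢0⇔ (suc x) y = mk⇔ (λ y≢0 _ → y≢0) (λ 1+x≢0⇒y≢0 → 1+x≢0⇒y≢0 λ ())

eqℕ≢0⇔ : ∀ x y → eqℕ x y ≢ 0 ⇔ x ≡ y
eqℕ≢0⇔ zero    zero    = mk⇔ (λ _ → refl) (λ _ ())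
eqℕ≢0⇔ zero    (suc y) = mk⇔ (λ 0≢0 → contradiction refl 0≢0) (λ ())
eqℕ≢0⇔ (suc x) zero    = mk⇔ (λ 0≢0 → contradiction refl 0≢0) (λ ())
eqℕ≢0⇔ (suc x) (suc y) =
  mk⇔ (cong suc ∘ Equivalence.to (eqℕ≢0⇔ x y)) (Equivalence.from (eqℕ≢0⇔ x y) ∘ suc-injective)

-- One entry per tag of Defs.code (⊥, ≐, atom, ¬, ∧, ∨, ⇒). The table h holds the truth
-- values of smaller codes, and variable i, coded as pair 0 i = 2 i + 1, is recovered by halving.
formulaCases : (c α β : ℕ) → (ℕ → ℕ) → (r k l : ℕ) → List ℕ
formulaCases c α β h r k l =
  0 ∷ eqℕ (digit c α (quot k 2)) (digit c α (quot l 2)) ∷ digit 2 β k ∷ isZero (h r) ∷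
  h k * h l ∷ h k + h l ∷ isZero (h k) + h l ∷ []

evalStep : Vec ℕ 5 → ℕ
evalStep (j ∷ table ∷ c ∷ α ∷ β ∷ []) =
  sg (select (unpair₁ j) (formulaCases c α β (digit 2 table) (unpair₂ j) (unpair₁ (unpair₂ j)) (unpair₂ (unpair₂ j))))

evalStepᶜ : Computable 5 evalStep
evalStepᶜ = resp-≗ (λ { (_ ∷ _ ∷ _ ∷ _ ∷ _ ∷ []) → refl }) (sgᶜ (selectᶜ (unpair₁ᶜ j)
  ( (-, zeroᶜ)
  ∷ (-, eqℕᶜ (digitᶜ c α (quotᶜ k two)) (digitᶜ c α (quotᶜ l two)))
  ∷ (-, digitᶜ two β k)
  ∷ (-, isZeroᶜ (h r))
  ∷ (-, h k *ᶜ h l)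
  ∷ (-, h k +ᶜ h l)
  ∷ (-, isZeroᶜ (h k) +ᶜ h l)
  ∷ [])))
  where
  j : Computable 5 (λ xs → lookup xs (# 0))
  j = projᶜ (# 0)
  c : Computable 5 (λ xs → lookup xs (# 2))
  c = projᶜ (# 2)
  α : Computable 5 (λ xs → lookup xs (# 3))
  α = projᶜ (# 3)
  β : Computable 5 (λ xs → lookup xs (# 4))
  β = projᶜ (# 4)
  two : Computable 5 (λ _ → 2)
  two = constᶜ 2
  r : Computable 5 (λ xs → unpair₂ (lookup xs (# 0)))
  r = unpair₂ᶜ j
  k : Computable 5 (λ xs → unpair₁ (unpair₂ (lookup xs (# 0))))
  k = unpair₁ᶜ r
  l : Computable 5 (λ xs → unpair₂ (unpair₂ (lookup xs (# 0))))
  l = unpair₂ᶜ r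
  h : ∀ {f} → Computable 5 f → Computable 5 (λ xs → digit 2 (lookup xs (# 1)) (f xs))
  h = digitᶜ two (projᶜ (# 1))

NatModel : ℕ → Structure S′
NatModel β = record { D = ℕ ; fun = λ () ; rel' = λ n _ → digit 2 β n ≢ 0 }

module Evaluation (c α β : ℕ) where

  open CourseOfValues evalStep

  private
    table : ℕ → ℕ → ℕ
    table j = digit 2 (history (c ∷ α ∷ β ∷ []) j)

    cases : ℕ → ℕ → ℕ → ℕ → List ℕ
    cases j = formulaCases c α β (table j)

  -- Opaque so that comparing truth at definitionally equal codes does not run the evaluator.
  opaque
    truth : ℕ → ℕ
    truth = value (c ∷ α ∷ β ∷ [])

    table-truth : ∀ {j s} → s < j → table j s ≡ truth s
    table-truth = digit-history (λ { (_ ∷ _ ∷ _ ∷ _ ∷ _ ∷ []) → sg<2 _ }) _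

    truth-pair : ∀ t r → truth (pair t r) ≡ sg (select t (cases (pair t r) r (unpair₁ r) (unpair₂ r)))
    truth-pair t r = cong₂ (λ t′ r′ → sg (select t′ (cases (pair t r) r′ (unpair₁ r′) (unpair₂ r′))))
      (unpair₁-pair t r) (unpair₂-pair t r)

  private
    truth-pair² : ∀ t k l → truth (pair t (pair k l)) ≡ sg (select t (cases (pair t (pair k l)) (pair k l) k l))
    truth-pair² t k l = trans (truth-pair t (pair k l))
      (cong₂ (λ k′ l′ → sg (select t (cases (pair t (pair k l)) (pair k l) k′ l′)))
        (unpair₁-pair k l) (unpair₂-pair k l))

    truth-connective : ∀ t k l (F : ℕ → ℕ → ℕ) →
      (∀ h → select t (formulaCases c α β h (pair k l) k l) ≡ F (h k) (h l)) →
      truth (pair t (pair k l)) ≡ sg (F (truth k) (truth l))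
    truth-connective t k l F selects-F = trans (truth-pair² t k l)
      (cong sg (trans (selects-F (table (pair t (pair k l))))
        (cong₂ F (table-truth (<-pair-pairˡ t k l)) (table-truth (<-pair-pairʳ t k l)))))

    half-pair₀ : ∀ i → quot (pair 0 i) 2 ≡ i
    half-pair₀ i = trans (cong (λ t → quot t 2) (*-identityˡ (suc (2 * i)))) (half-odd i)

  truth-correct : ∀ φ → QF φ → truth (code φ) ≢ 0 ⇔ NatModel β , digit c α ⊨ φ
  truth-correct ⊥' qf-⊥ =
    mk⇔ (λ 0≢0 → 0≢0 refl) (λ ()) ⇔-∘ ≡sg⇒≢0⇔ (truth-pair 0 0)
  truth-correct (var i ≐ var j) qf-≐ =
    eqℕ≢0⇔ (digit c α i) (digit c α j) ⇔-∘ ≡sg⇒≢0⇔ (trans (truth-pair² 1 (pair 0 i) (pair 0 j))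
      (cong₂ (λ i′ j′ → sg (eqℕ (digit c α i′) (digit c α j′))) (half-pair₀ i) (half-pair₀ j)))
  truth-correct (var _ ≐ app () _) qf-≐
  truth-correct (app () _ ≐ _) qf-≐
  truth-correct (rel n []) qf-r = ≡sg⇒≢0⇔ (truth-pair² 2 n 0)
  truth-correct (¬' φ) (qf-¬ q) =
    ¬-cong-⇔ (truth-correct φ q) ⇔-∘ (isZero≢0⇔ (truth (code φ)) ⇔-∘
    ≡sg⇒≢0⇔ (trans (truth-pair 3 (code φ)) (cong (sg ∘ isZero) (table-truth (<-pairʳ 3 (code φ))))))
  truth-correct (φ ∧' ψ) (qf-∧ q q′) =
    (truth-correct φ q ×-⇔ truth-correct ψ q′) ⇔-∘ (*≢0⇔ (truth (code φ)) (truth (code ψ)) ⇔-∘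
    ≡sg⇒≢0⇔ (truth-connective 4 (code φ) (code ψ) _*_ (λ _ → refl)))
  truth-correct (φ ∨' ψ) (qf-∨ q q′) =
    (truth-correct φ q ⊎-⇔ truth-correct ψ q′) ⇔-∘ (+≢0⇔ (truth (code φ)) (truth (code ψ)) ⇔-∘
    ≡sg⇒≢0⇔ (truth-connective 5 (code φ) (code ψ) _+_ (λ _ → refl)))
  truth-correct (φ ⇒' ψ) (qf-⇒ q q′) =
    →-cong-⇔ (truth-correct φ q) (truth-correct ψ q′) ⇔-∘ (isZero+≢0⇔ (truth (code φ)) (truth (code ψ)) ⇔-∘
    ≡sg⇒≢0⇔ (truth-connective 6 (code φ) (code ψ) (λ x y → isZero x + y) (λ _ → refl)))

opaque
  unfolding Evaluation.truth

  truthᶜ : Computable 4 (λ { (j ∷ c ∷ α ∷ β ∷ []) → Evaluation.truth c α β j })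
  truthᶜ = resp-≗ (λ { (_ ∷ _ ∷ _ ∷ _ ∷ []) → refl }) (CourseOfValues.valueᶜ evalStep evalStepᶜ)

least : ∀ {P : ℕ → Set} i → (∀ {j} → j ≤ i → Dec (P j)) → P i →
  Σ ℕ λ m → m ≤ i × P m × (∀ {j} → j < m → ¬ P j)
least zero P? Pi = 0 , z≤n , Pi , λ ()
least {P} (suc i) P? Pi with P? z≤n
... | yes P0 = 0 , z≤n , P0 , λ ()
... | no ¬P0 with least {P ∘ suc} i (P? ∘ s≤s) Pi
...   | m , m≤i , Pm , none-below = suc m , s≤s m≤i , Pm , λ { {zero} _ → ¬P0 ; {suc j} (s≤s j<m) → none-below j<m }

module AgreeingNatModel {M : Structure S′} {a : Assignment M} {c : ℕ}
  (≡? : ∀ {i j} → i < c → j < c → Dec (a i ≡ a j)) (rel? : ∀ {n} → n < c → Dec (rel' M n [])) where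

  private
    representative : ℕ → ℕ
    representative i with i <? c
    ... | yes i<c = proj₁ (least i (λ j≤i → ≡? (≤-<-trans j≤i i<c) i<c) refl)
    ... | no _    = 0

    representative-spec : ∀ {i} → i < c →
      representative i ≤ i × a (representative i) ≡ a i × (∀ {j} → j < representative i → a j ≢ a i)
    representative-spec {i} i<c with i <? c
    ... | yes i<c′ = proj₂ (least i (λ j≤i → ≡? (≤-<-trans j≤i i<c′) i<c′) refl)
    ... | no i≮c   = contradiction i<c i≮c

    representative-< : ∀ {i} → i < c → representative i < c
    representative-< i<c = ≤-<-trans (proj₁ (representative-spec i<c)) i<c

    same-representative : ∀ {i j} → i < c → j < c → a i ≡ a j ⇔ representative i ≡ representative j
    same-representative {i} {j} i<c j<c
      with representative i | representative-spec i<c | representative j | representative-spec j<c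
    ... | rᵢ | _ , a-rᵢ , below-rᵢ | rⱼ | _ , a-rⱼ , below-rⱼ = mk⇔ to from
      where
      to : a i ≡ a j → rᵢ ≡ rⱼ
      to aᵢ≡aⱼ with <-cmp rᵢ rⱼ
      ... | tri< rᵢ<rⱼ _ _ = contradiction (trans a-rᵢ aᵢ≡aⱼ) (below-rⱼ rᵢ<rⱼ)
      ... | tri≈ _ rᵢ≡rⱼ _ = rᵢ≡rⱼ
      ... | tri> _ _ rⱼ<rᵢ = contradiction (trans a-rⱼ (sym aᵢ≡aⱼ)) (below-rᵢ rⱼ<rᵢ)
      from : rᵢ ≡ rⱼ → a i ≡ a j
      from rᵢ≡rⱼ = trans (sym a-rᵢ) (trans (cong a rᵢ≡rⱼ) a-rⱼ)

    bit : ℕ → ℕ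
    bit n with n <? c
    ... | no _ = 0
    ... | yes n<c with rel? n<c
    ...   | yes _ = 1
    ...   | no _  = 0

    bit-< : ∀ {n} → n < c → bit n < 2
    bit-< {n} _ with n <? c
    ... | no _ = s≤s z≤n
    ... | yes n<c with rel? n<c
    ...   | yes _ = ≤-refl
    ...   | no _  = s≤s z≤n

    bit-spec : ∀ {n} → n < c → rel' M n [] ⇔ bit n ≢ 0
    bit-spec {n} n<c with n <? c
    ... | no n≮c = contradiction n<c n≮c
    ... | yes n<c′ with rel? n<c′
    ...   | yes atom = mk⇔ (λ _ ()) (λ _ → atom)
    ...   | no ¬atom = mk⇔ (λ atom → contradiction atom ¬atom) (λ 0≢0 → contradiction refl 0≢0)

  α β : ℕ
  α = fromDigits c representative c
  β = fromDigits 2 bit c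

  α<c^c : α < c ^ c
  α<c^c = fromDigits-< representative-<

  β<2^c : β < 2 ^ c
  β<2^c = fromDigits-< bit-<

  agree : Agree c M (NatModel β) a (digit c α)
  agree = record
    { ≡-agree = λ i<c j<c → subst₂ (λ x y → _ ⇔ x ≡ y) (sym (digit-fromDigits representative-< i<c))
                              (sym (digit-fromDigits representative-< j<c)) (same-representative i<c j<c)
    ; rel-agree = λ n<c → subst (λ x → _ ⇔ x ≢ 0) (sym (digit-fromDigits bit-< n<c)) (bit-spec n<c)
    }

¬¬-bounded : ∀ {P : ℕ → Set} → (∀ i → ¬ ¬ P i) → ∀ N → ¬ ¬ (∀ {i} → i < N → P i)
¬¬-bounded ¬¬P zero    k = k λ ()
¬¬-bounded ¬¬P (suc N) k = ¬¬-bounded ¬¬P N λ below → ¬¬P N λ PN → k λ {i} i<1+N →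
  [ below , (λ { refl → PN }) ] (m<1+n⇒m<n∨m≡n i<1+N)

¬¬-decidable-atoms : ∀ (M : Structure S′) (a : Assignment M) c →
  ¬ ¬ ((∀ {i j} → i < c → j < c → Dec (a i ≡ a j)) × (∀ {n} → n < c → Dec (rel' M n [])))
¬¬-decidable-atoms M a c k =
  ¬¬-bounded (λ _ → ¬¬-bounded (λ _ → ¬¬-excluded-middle) c) c λ ≡? →
  ¬¬-bounded (λ _ → ¬¬-excluded-middle) c λ rel? →
  k ((λ i<c → ≡? i<c) , rel?)

-- The variables and predicate symbols of φ lie below c = code φ, so it suffices to try the
-- assignments given by the base-c digits of α < c ^ c and the atoms given by the bits of β < 2 ^ c.
search : ℕ → ℕ
search c = sumBelow (c ^ c) λ α → sumBelow (2 ^ c) λ β → Evaluation.truth c α β c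

decide : ℕ → ℕ
decide c = isZero (search c)

decideᶜ : Computable 1 (unary decide)
decideᶜ = resp-≗ (λ { (_ ∷ []) → refl }) (isZeroᶜ
  (boundedSumᶜ (projᶜ (# 0) ^ᶜ projᶜ (# 0)) (boundedSumᶜ (constᶜ 2 ^ᶜ projᶜ (# 1))
    (compose truthᶜ (projᶜ (# 2) ∷ᶜ projᶜ (# 2) ∷ᶜ projᶜ (# 1) ∷ᶜ projᶜ (# 0) ∷ᶜ []ᶜ)))))

sumBelow≢0 : ∀ N g → sumBelow N g ≢ 0 → ∃ λ i → g i ≢ 0
sumBelow≢0 zero    g sum≢0 = contradiction refl sum≢0
sumBelow≢0 (suc N) g sum≢0 with g N in gN
... | suc _ = N , λ gN≡0 → contradiction (trans (sym gN) gN≡0) λ ()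
... | zero  = sumBelow≢0 N g (sum≢0 ∘ trans (+-identityʳ (sumBelow N g)))

search≢0⇒sat : ∀ φ → QF φ → search (code φ) ≢ 0 → Sat T′ φ
search≢0⇒sat φ qf search≢0
  with sumBelow≢0 (code φ ^ code φ) (λ α → sumBelow (2 ^ code φ) λ β → Evaluation.truth (code φ) α β (code φ))
                   search≢0
... | α , inner≢0 with sumBelow≢0 (2 ^ code φ) (λ β → Evaluation.truth (code φ) α β (code φ)) inner≢0
... | β , truth≢0 = NatModel β , digit (code φ) α , fresh⇒T′-model (NatModel β) fresh-ℕ _ ,
                    Equivalence.to (Evaluation.truth-correct (code φ) α β φ qf) truth≢0

-- The claim is negative, so equality and the atoms of the model may be assumed decidable.
sat⇒search≢0 : ∀ φ → QF φ → Sat T′ φ → search (code φ) ≢ 0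
sat⇒search≢0 φ qf (M , a , _ , sat) search≡0 = ¬¬-decidable-atoms M a c λ (≡? , rel?) →
  let open AgreeingNatModel {M} {a} {c} ≡? rel?
      open Evaluation c α β
      truth≢0 : truth c ≢ 0
      truth≢0 = Equivalence.from (truth-correct φ qf) (Equivalence.to (⊨-transfer agree φ qf ≤-refl) sat)
      truth≤search : truth c ≤ search c
      truth≤search = ≤-trans (≤-sumBelow (λ β′ → Evaluation.truth c α β′ c) β<2^c)
                             (≤-sumBelow (λ α′ → sumBelow (2 ^ c) λ β′ → Evaluation.truth c α′ β′ c) α<c^c)
  in truth≢0 (n≤0⇒n≡0 (subst (truth c ≤_) search≡0 truth≤search))
  where
  c : ℕ
  c = code φ

isZero≡0⇒≢0 : ∀ {x} → isZero x ≡ 0 → x ≢ 0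
isZero≡0⇒≢0 {zero} ()

isZero≢0⇒≡0 : ∀ {x} → isZero x ≢ 0 → x ≡ 0
isZero≢0⇒≡0 {zero}  _         = refl
isZero≢0⇒≡0 {suc _} isZero≢0 = contradiction refl isZero≢0

T′-decidable : Decidable T′
T′-decidable = proj₁ decideᶜ , λ φ qf →
  decide (code φ) , proj₂ decideᶜ (code φ ∷ []) ,
  search≢0⇒sat φ qf ∘ isZero≡0⇒≢0 , (λ decide≢0 sat → sat⇒search≢0 φ qf sat (isZero≢0⇒≡0 decide≢0))

Π-⇔ : ∀ {A : Set} {P Q : A → Set} → (∀ x → P x ⇔ Q x) → (∀ x → P x) ⇔ (∀ x → Q x)
Π-⇔ P⇔Q = mk⇔ (λ p x → Equivalence.to (P⇔Q x) (p x)) (λ q x → Equivalence.from (P⇔Q x) (q x))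

module _ {S₁ S₂ : Signature} where

  reduct₁ : Structure (S₁ ⊕ S₂) → Structure S₁
  reduct₁ N = record { D = D N ; fun = λ f → fun N (inj₁ f) ; rel' = λ r → rel' N (inj₁ r) }

  reduct₂ : Structure (S₁ ⊕ S₂) → Structure S₂
  reduct₂ N = record { D = D N ; fun = λ f → fun N (inj₂ f) ; rel' = λ r → rel' N (inj₂ r) }

  module _ (N : Structure (S₁ ⊕ S₂)) where

    mutual
      evalT-lift₁ : ∀ a (t : Term S₁) → evalT N a (liftT₁ t) ≡ evalT (reduct₁ N) a t
      evalT-lift₁ a (var x)    = refl
      evalT-lift₁ a (app f ts) = cong (fun N (inj₁ f)) (evalV-lift₁ a ts)

      evalV-lift₁ : ∀ a {n} (ts : Vec (Term S₁) n) → evalV N a (liftV₁ ts) ≡ evalV (reduct₁ N) a ts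
      evalV-lift₁ a []       = refl
      evalV-lift₁ a (t ∷ ts) = cong₂ _∷_ (evalT-lift₁ a t) (evalV-lift₁ a ts)

    mutual
      evalT-lift₂ : ∀ a (t : Term S₂) → evalT N a (liftT₂ t) ≡ evalT (reduct₂ N) a t
      evalT-lift₂ a (var x)    = refl
      evalT-lift₂ a (app f ts) = cong (fun N (inj₂ f)) (evalV-lift₂ a ts)

      evalV-lift₂ : ∀ a {n} (ts : Vec (Term S₂) n) → evalV N a (liftV₂ ts) ≡ evalV (reduct₂ N) a ts
      evalV-lift₂ a []       = refl
      evalV-lift₂ a (t ∷ ts) = cong₂ _∷_ (evalT-lift₂ a t) (evalV-lift₂ a ts)

    ⊨-lift₁ : ∀ a (φ : Formula S₁) → N , a ⊨ lift₁ φ ⇔ reduct₁ N , a ⊨ φ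
    ⊨-lift₁ a ⊥'         = mk⇔ id id
    ⊨-lift₁ a (t ≐ u)    = mk⇔ (λ eq → trans (sym (evalT-lift₁ a t)) (trans eq (evalT-lift₁ a u)))
                               (λ eq → trans (evalT-lift₁ a t) (trans eq (sym (evalT-lift₁ a u))))
    ⊨-lift₁ a (rel r ts) = mk⇔ (subst (rel' N (inj₁ r)) (evalV-lift₁ a ts))
                               (subst (rel' N (inj₁ r)) (sym (evalV-lift₁ a ts)))
    ⊨-lift₁ a (¬' φ)     = ¬-cong-⇔ (⊨-lift₁ a φ)
    ⊨-lift₁ a (φ ∧' ψ)   = ⊨-lift₁ a φ ×-⇔ ⊨-lift₁ a ψ
    ⊨-lift₁ a (φ ∨' ψ)   = ⊨-lift₁ a φ ⊎-⇔ ⊨-lift₁ a ψ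
    ⊨-lift₁ a (φ ⇒' ψ)   = →-cong-⇔ (⊨-lift₁ a φ) (⊨-lift₁ a ψ)
    ⊨-lift₁ a (∀' x φ)   = Π-⇔ λ d → ⊨-lift₁ (update a x d) φ
    ⊨-lift₁ a (∃' x φ)   = Σ-⇔ (↠-id _) (⊨-lift₁ (update a x _) φ)

    ⊨-lift₂ : ∀ a (φ : Formula S₂) → N , a ⊨ lift₂ φ ⇔ reduct₂ N , a ⊨ φ
    ⊨-lift₂ a ⊥'         = mk⇔ id id
    ⊨-lift₂ a (t ≐ u)    = mk⇔ (λ eq → trans (sym (evalT-lift₂ a t)) (trans eq (evalT-lift₂ a u)))
                               (λ eq → trans (evalT-lift₂ a t) (trans eq (sym (evalT-lift₂ a u))))
    ⊨-lift₂ a (rel r ts) = mk⇔ (subst (rel' N (inj₂ r)) (evalV-lift₂ a ts))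
                               (subst (rel' N (inj₂ r)) (sym (evalV-lift₂ a ts)))
    ⊨-lift₂ a (¬' φ)     = ¬-cong-⇔ (⊨-lift₂ a φ)
    ⊨-lift₂ a (φ ∧' ψ)   = ⊨-lift₂ a φ ×-⇔ ⊨-lift₂ a ψ
    ⊨-lift₂ a (φ ∨' ψ)   = ⊨-lift₂ a φ ⊎-⇔ ⊨-lift₂ a ψ
    ⊨-lift₂ a (φ ⇒' ψ)   = →-cong-⇔ (⊨-lift₂ a φ) (⊨-lift₂ a ψ)
    ⊨-lift₂ a (∀' x φ)   = Π-⇔ λ d → ⊨-lift₂ (update a x d) φ
    ⊨-lift₂ a (∃' x φ)   = Σ-⇔ (↠-id _) (⊨-lift₂ (update a x _) φ)

    module _ {T₁ : Theory S₁} {T₂ : Theory S₂} {a : Assignment N} where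

      ⊔-model⇒reducts : IsModel (T₁ ⊔ T₂) N a → IsModel T₁ (reduct₁ N) a × IsModel T₂ (reduct₂ N) a
      ⊔-model⇒reducts model =
        (λ φ ax → Equivalence.to (⊨-lift₁ a φ) (model _ (ax₁ ax))) ,
        (λ φ ax → Equivalence.to (⊨-lift₂ a φ) (model _ (ax₂ ax)))

      reducts⇒⊔-model : IsModel T₁ (reduct₁ N) a → IsModel T₂ (reduct₂ N) a → IsModel (T₁ ⊔ T₂) N a
      reducts⇒⊔-model model₁ _ _ (ax₁ {φ} ax) = Equivalence.from (⊨-lift₁ a φ) (model₁ φ ax)
      reducts⇒⊔-model _ model₂ _ (ax₂ {φ} ax) = Equivalence.from (⊨-lift₂ a φ) (model₂ φ ax)

QF-lift₁ : ∀ {S₁ S₂} {φ : Formula S₁} → QF φ → QF (lift₁ {S₁} {S₂} φ)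
QF-lift₁ qf-⊥        = qf-⊥
QF-lift₁ qf-≐        = qf-≐
QF-lift₁ qf-r        = qf-r
QF-lift₁ (qf-¬ q)    = qf-¬ (QF-lift₁ q)
QF-lift₁ (qf-∧ q q′) = qf-∧ (QF-lift₁ q) (QF-lift₁ q′)
QF-lift₁ (qf-∨ q q′) = qf-∨ (QF-lift₁ q) (QF-lift₁ q′)
QF-lift₁ (qf-⇒ q q′) = qf-⇒ (QF-lift₁ q) (QF-lift₁ q′)

expandAtoms : ∀ {S} → Structure S → (ℕ → Set) → Structure (S ⊕ S′)
expandAtoms M P = record
  { D = D M
  ; fun = λ { (inj₁ f) → fun M f ; (inj₂ ()) }
  ; rel' = λ { (inj₁ r) → rel' M r ; (inj₂ n) _ → P n }
  }

module _ {S : Signature} where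

  conjAtom : (φ : Formula S) → ℕ → Formula (S ⊕ S′)
  conjAtom φ n = lift₁ φ ∧' lift₂ (rel n [])

  conjAtom-codeᶜ : ∀ φ → Computable 1 (unary (code ∘ conjAtom φ))
  conjAtom-codeᶜ φ = resp-≗ (λ { (_ ∷ []) → refl })
    (pairᶜ (constᶜ 4) (pairᶜ (constᶜ (code (lift₁ {S} {S′} φ)))
      (pairᶜ (constᶜ 2) (pairᶜ (sucᶜ (constᶜ 2 *ᶜ projᶜ (# 0))) zeroᶜ))))

  query : Formula S → μR 1 → μR 1
  query φ e = comp e (proj₁ (conjAtom-codeᶜ φ) ∷ [])

  query-eval : ∀ φ e {n b} → Eval e (code (conjAtom φ n) ∷ []) b → Eval (query φ e) (n ∷ []) b
  query-eval φ e {n} ev = e-comp (ev-∷ (proj₂ (conjAtom-codeᶜ φ) (n ∷ [])) ev-[]) ev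

  expansion-model : ∀ {T : Theory S} {M a n} → IsModel T M a → ¬ Diagonal n →
    IsModel (T ⊔ T′) (expandAtoms M (_≡ n)) a
  expansion-model {T} {M} {a} {n} T-model ¬diag = reducts⇒⊔-model (expandAtoms M (_≡ n)) {T₁ = T} T-model
    (T′-model-without-diagonal-atoms (reduct₂ (expandAtoms M (_≡ n))) (λ { diag refl → ¬diag diag }) a)

  ⊔-model⇒infinite : ∀ {T : Theory S} {N a n} → IsModel (T ⊔ T′) N a → Diagonal n → rel' N (inj₂ n) [] →
    Infinite (D N)
  ⊔-model⇒infinite {T} {N} {a} model diag atom =
    fresh⇒infinite (a 0) (T′-model⇒fresh (reduct₂ N) (proj₂ (⊔-model⇒reducts N {T₁ = T} model)) diag atom)

combination-decidable⇒stablyInfinite : ∀ {S} (T : Theory S) → Decidable (T ⊔ T′) → StablyInfinite T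
combination-decidable⇒stablyInfinite {S} T (e , decides) φ qf (M , a , T-model , sat) =
  by-answer (decides ψ (qf-∧ (QF-lift₁ qf) qf-r))
  where
  G : μR 1
  G = query φ e
  ψ : Formula (S ⊕ S′)
  ψ = conjAtom φ ⌜ G ⌝

  by-answer : (Σ ℕ λ b → Eval e (code ψ ∷ []) b × (b ≡ 0 → Sat (T ⊔ T′) ψ) × (b ≢ 0 → ¬ Sat (T ⊔ T′) ψ)) →
    SatInf T φ
  by-answer (zero , ev , sat-ψ , _) = infinite-model (sat-ψ refl)
    where
    diag : Diagonal ⌜ G ⌝
    diag = diagonal-zero G (query-eval φ e {⌜ G ⌝} ev)
    infinite-model : Sat (T ⊔ T′) ψ → SatInf T φ
    infinite-model (N , b , model , sat-φ , atom) =
      reduct₁ N , ⊔-model⇒infinite {T = T} {N} {b} model diag atom , b ,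
      proj₁ (⊔-model⇒reducts N {T₁ = T} {T₂ = T′} model) , Equivalence.to (⊨-lift₁ N b φ) sat-φ
  by-answer (suc _ , ev , _ , unsat-ψ) = contradiction sat-ψ (unsat-ψ λ ())
    where
    ¬diag : ¬ Diagonal ⌜ G ⌝
    ¬diag = diagonal-suc G (query-eval φ e {⌜ G ⌝} ev)
    model : IsModel (T ⊔ T′) (expandAtoms M (_≡ ⌜ G ⌝)) a
    model = expansion-model {T = T} {M} {a} T-model ¬diag
    sat-φ : expandAtoms M (_≡ ⌜ G ⌝) , a ⊨ lift₁ φ
    sat-φ = Equivalence.from (⊨-lift₁ (expandAtoms M (_≡ ⌜ G ⌝)) a φ) sat
    sat-ψ : Sat (T ⊔ T′) ψ
    sat-ψ = expandAtoms M (_≡ ⌜ G ⌝) , a , model , sat-φ , refl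

theorem4p8 : Σ Signature λ S′ → Σ (Theory S′) λ T′ →
    Decidable T′ × StablyInfinite T′ ×
    (∀ (S : Signature) (T : Theory S) → Decidable T → Decidable (T ⊔ T′) → StablyInfinite T)
theorem4p8 = S′ , T′ , T′-decidable , T′-stablyInfinite , λ S T _ → combination-decidable⇒stablyInfinite T
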